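{- If $t$ is a term such that $t\to^* u$ and $t\to^* v$, then there exists a term $w$ such that $u\to^* w$ and $v\to^* w$.
   Context: Pseudo-terms are given by the grammar $t ::= x \mid \lambda x.t \mid (t\,t') \mid\, !t \mid \mathrm{let}\ t\ \mathrm{be}\ !x\ \mathrm{in}\ t'$. In $\mathrm{let}\ u\ \mathrm{be}\ !x\ \mathrm{in}\ t_1$ the variable $x$ is bound in $t_1$: $FV(\mathrm{let}\ u\ \mathrm{be}\ !x\ \mathrm{in}\ t_1)=FV(u)\cup(FV(t_1)\setminus\{x\})$; $\lambda$ binds as usual. $FV(t)$ is the set of free variables of $t$, and $no(x,t)$ is the number of free occurrences of $x$ in $t$. Terms and their sets of temporary variables $TV(t)\subseteq FV(t)$ are defined simultaneously as the smallest set of pseudo-terms such that: (i) a variable $x$ is a term, $TV(x)=\emptyset$; (ii) $\lambda x.t$ is a term iff $t$ is a term, $x\notin TV(t)$ and $no(x,t)\le 1$, and then $TV(\lambda x.t)=TV(t)$; (iii) $(t_1\,t_2)$ is a term iff $t_1,t_2$ are terms, $TV(t_1)\cap FV(t_2)=\emptyset$ and $FV(t_1)\cap TV(t_2)=\emptyset$, and then $TV(t_1\,t_2)=TV(t_1)\cup TV(t_2)$; (iv) $!t$ is a term iff $t$ is a term, $TV(t)=\emptyset$ and $no(x,t)=1$ for all $x\in FV(t)$, and then $TV(!t)=FV(t)$; (v) $\mathrm{let}\ t_1\ \mathrm{be}\ !x\ \mathrm{in}\ t_2$ is a term iff $t_1,t_2$ are terms, $TV(t_1)\cap FV(t_2)=\emptyset$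 and $FV(t_1)\cap TV(t_2)=\emptyset$, and then its $TV$ is $TV(t_1)\cup(TV(t_2)\setminus\{x\})$. One-step reduction $\to$ is the contextual closure of the rules: $(\beta)$ $((\lambda x.t)\,u)\to t[u/x]$; (bang) $\mathrm{let}\ !u\ \mathrm{be}\ !x\ \mathrm{in}\ t\to t[u/x]$; (com1) $\mathrm{let}\ (\mathrm{let}\ t_1\ \mathrm{be}\ !y\ \mathrm{in}\ t_2)\ \mathrm{be}\ !x\ \mathrm{in}\ t_3 \to \mathrm{let}\ t_1\ \mathrm{be}\ !y\ \mathrm{in}\ (\mathrm{let}\ t_2\ \mathrm{be}\ !x\ \mathrm{in}\ t_3)$; (com2) $((\mathrm{let}\ t_1\ \mathrm{be}\ !x\ \mathrm{in}\ t_2)\ t_3)\to \mathrm{let}\ t_1\ \mathrm{be}\ !x\ \mathrm{in}\ (t_2\,t_3)$. Here $t[u/x]$ denotes capture-avoiding substitution. $\to^*$ denotes the reflexive-transitive closure of $\to$. -}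

module Defs where

open import Data.Nat using (ℕ; zero; suc; _+_; _≤_; _<_)
open import Data.Maybe using (Maybe; just; nothing; maybe)
import Data.Maybe
open import Data.Empty using (⊥)
open import Data.Sum using (_⊎_)
open import Relation.Nullary using (¬_)
open import Relation.Binary.PropositionalEquality using (_≡_)
open import Relation.Binary.Construct.Closure.ReflexiveTransitive using (Star)

-- Pseudo-terms, in de Bruijn notation (terms up to alpha-equivalence).
-- `lam t` binds index 0 in t; `letb u t` is  let u be !x in t,
-- binding x as index 0 in t (not in u).
data PTerm : Set where
  var  : ℕ → PTerm
  lam  : PTerm → PTerm
  app  : PTerm → PTerm → PTerm
  bang : PTerm → PTerm
  letb : PTerm → PTerm → PTerm

eqℕ : ℕ → ℕ → ℕ
eqℕ zero    zero    = 1
eqℕ zero    (suc _) = 0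
eqℕ (suc _) zero    = 0
eqℕ (suc m) (suc n) = eqℕ m n

no : ℕ → PTerm → ℕ
no x (var y)    = eqℕ x y
no x (lam t)    = no (suc x) t
no x (app t u)  = no x t + no x u
no x (bang t)   = no x t
no x (letb u t) = no x u + no (suc x) t

FV : PTerm → ℕ → Set
FV t x = 1 ≤ no x t

TV : PTerm → ℕ → Set
TV (var _)    x = ⊥
TV (lam t)    x = TV t (suc x)
TV (app t u)  x = TV t x ⊎ TV u x
TV (bang t)   x = FV t x
TV (letb u t) x = TV u x ⊎ TV t (suc x)

data IsTerm : PTerm → Set where
  var  : ∀ x → IsTerm (var x)
  lam  : ∀ {t} → IsTerm t → ¬ TV t 0 → no 0 t ≤ 1 → IsTerm (lam t)
  app  : ∀ {t u} → IsTerm t → IsTerm u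
       → (∀ x → TV t x → ¬ FV u x)
       → (∀ x → FV t x → ¬ TV u x)
       → IsTerm (app t u)
  bang : ∀ {t} → IsTerm t → (∀ x → ¬ TV t x)
       → (∀ x → FV t x → no x t ≡ 1)
       → IsTerm (bang t)
  letb : ∀ {u t} → IsTerm u → IsTerm t
       → (∀ x → TV u x → ¬ FV t (suc x))
       → (∀ x → FV u x → ¬ TV t (suc x))
       → IsTerm (letb u t)

shiftVar : ℕ → ℕ → ℕ
shiftVar zero    x       = suc x
shiftVar (suc c) zero    = zero
shiftVar (suc c) (suc x) = suc (shiftVar c x)

shift : ℕ → PTerm → PTerm
shift c (var x)    = var (shiftVar c x)
shift c (lam t)    = lam (shift (suc c) t)
shift c (app t u)  = app (shift c t) (shift c u)
shift c (bang t)   = bang (shift c t)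
shift c (letb u t) = letb (shift c u) (shift (suc c) t)

-- varSubst j x : nothing if x = j; otherwise the new index of x after
-- removing binder j (indices above j are decremented).
varSubst : ℕ → ℕ → Maybe ℕ
varSubst zero    zero    = nothing
varSubst zero    (suc x) = just x
varSubst (suc j) zero    = just zero
varSubst (suc j) (suc x) = Data.Maybe.map suc (varSubst j x)

substVar : ℕ → PTerm → ℕ → PTerm
substVar j u x = maybe var u (varSubst j x)

subst : ℕ → PTerm → PTerm → PTerm
subst j u (var x)    = substVar j u x
subst j u (lam t)    = lam (subst (suc j) (shift 0 u) t)
subst j u (app t s)  = app (subst j u t) (subst j u s)
subst j u (bang t)   = bang (subst j u t)
subst j u (letb s t) = letb (subst j u s) (subst (suc j) (shift 0 u) t)

_[_] : PTerm → PTerm → PTerm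
t [ u ] = subst 0 u t

infix 4 _⟶_
data _⟶_ : PTerm → PTerm → Set where
  β    : ∀ {t u} → app (lam t) u ⟶ t [ u ]
  !β   : ∀ {u t} → letb (bang u) t ⟶ t [ u ]
  com1 : ∀ {t₁ t₂ t₃} →
         letb (letb t₁ t₂) t₃ ⟶ letb t₁ (letb t₂ (shift 1 t₃))
  com2 : ∀ {t₁ t₂ t₃} →
         app (letb t₁ t₂) t₃ ⟶ letb t₁ (app t₂ (shift 0 t₃))
  ξlam  : ∀ {t t'} → t ⟶ t' → lam t ⟶ lam t'
  ξappl : ∀ {t t' u} → t ⟶ t' → app t u ⟶ app t' u
  ξappr : ∀ {t u u'} → u ⟶ u' → app t u ⟶ app t u'
  ξbang : ∀ {t t'} → t ⟶ t' → bang t ⟶ bang t'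
  ξletl : ∀ {u u' t} → u ⟶ u' → letb u t ⟶ letb u' t
  ξletr : ∀ {u t t'} → t ⟶ t' → letb u t ⟶ letb u t'

infix 4 _⟶*_
_⟶*_ : PTerm → PTerm → Set
_⟶*_ = Star _⟶_

{-# OPTIONS --safe #-}
-- Reduction splits into the β-part (β and bang) and the commuting conversions
-- (com1, com2).  The β-part is confluent by parallel reduction and complete
-- developments.  The commuting conversions decrease a weight in which heads count
-- twice, and their critical pairs close, so they are confluent by Newman's lemma.
-- A commuting conversion against a β-step closes with at most one β-step on the
-- other side, so the two reductions commute and their union is confluent by the
-- Hindley–Rosen lemma.  This holds for all pseudo-terms; the common reduct is a
-- term by subject reduction.  For the latter, term-hood is recast with occurrence
-- counts: TV(t) is the set of variables occurring inside a !-box, every side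
-- condition becomes the vanishing of a product of counts, and the counts of
-- t[u/x] are explicit polynomials in those of t and u.
module Submission where

open import Defs
open import Level using (0ℓ)
open import Data.Nat using (ℕ; zero; suc; _+_; _*_; _≤_; _<_; z≤n; s≤s)
open import Data.Nat.Properties
open import Data.Nat.Induction using (<-wellFounded)
open import Data.Nat.Solver using (module +-*-Solver)
import Algebra.Properties.CommutativeSemigroup as CommutativeSemigroupProperties
open CommutativeSemigroupProperties +-commutativeSemigroup
  using () renaming (interchange to +-interchange)
open CommutativeSemigroupProperties *-commutativeSemigroup
  using (x∙yz≈y∙xz) renaming (interchange to *-interchange)
open import Data.Maybe using (Maybe; just; nothing; maybe)
import Data.Maybe as Maybe
open import Data.Product using (Σ; ∃; _×_; _,_; -,_; proj₁; proj₂)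
open import Data.Sum using (_⊎_; inj₁; inj₂)
import Data.Sum as Sum
open import Data.Empty using (⊥-elim)
open import Function using (_∘_)
open import Induction.WellFounded using (module Subrelation)
open import Relation.Nullary using (¬_)
open import Relation.Binary.Core using (Rel; _⇒_)
open import Relation.Binary.Definitions using (tri<; tri≈; tri>)
import Relation.Binary.Construct.On as On
open import Relation.Binary.Construct.Union using (_∪_)
open import Relation.Binary.Construct.Closure.ReflexiveTransitive
  using (Star; ε; _◅_; _◅◅_; gmap; map; return; _⋆)
open import Relation.Binary.Construct.Closure.Transitive
  using (Plus; _∼⁺⟨_⟩_) renaming ([_] to [_]⁺)
open import Relation.Binary.PropositionalEquality
  using (_≡_; refl; sym; trans; cong; cong₂; module ≡-Reasoning)
open import Relation.Binary.Rewriting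
  using (Confluent; WeaklyConfluent; StronglyNormalizing; sn&wcr⇒cr)

-- Abstract rewriting

module _ {A : Set} where

  Diamond : Rel A 0ℓ → Set
  Diamond R = ∀ {a b c} → R a b → R a c → ∃ λ d → R b d × R c d

  Commute : Rel A 0ℓ → Rel A 0ℓ → Set
  Commute R S = ∀ {a b c} → Star R a b → Star S a c → ∃ λ d → Star S b d × Star R c d

  diamond-strip : ∀ {R : Rel A 0ℓ} → Diamond R →
    ∀ {a b c} → R a b → Star R a c → ∃ λ d → Star R b d × R c d
  diamond-strip ◇ r ε = -, ε , r
  diamond-strip ◇ r (r′ ◅ rs) with ◇ r r′
  ... | _ , r₁ , r₂ with diamond-strip ◇ r₂ rs
  ...   | _ , rs₁ , r₃ = -, r₁ ◅ rs₁ , r₃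

  diamond⇒confluent : ∀ {R : Rel A 0ℓ} → Diamond R → Confluent R
  diamond⇒confluent ◇ ε        rs′ = -, rs′ , ε
  diamond⇒confluent ◇ (r ◅ rs) rs′ with diamond-strip ◇ r rs′
  ... | _ , rs₁ , r₁ with diamond⇒confluent ◇ rs rs₁
  ...   | _ , rs₂ , rs₃ = -, rs₂ , r₁ ◅ rs₃

  confluent-between : ∀ {R S : Rel A 0ℓ} → R ⇒ S → S ⇒ Star R → Confluent S → Confluent R
  confluent-between R⇒S S⇒R* conf rs₁ rs₂ with conf (map R⇒S rs₁) (map R⇒S rs₂)
  ... | _ , ss₁ , ss₂ = -, (S⇒R* ⋆) ss₁ , (S⇒R* ⋆) ss₂

  local-commutation⇒commute : ∀ {R S : Rel A 0ℓ} →
    (∀ {a b c} → R a b → S a c → ∃ λ d → (b ≡ d ⊎ S b d) × Star R c d) → Commute R S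
  local-commutation⇒commute {R} {S} local = commute
    where
    step : ∀ {a b c} → Star R a b → S a c → ∃ λ d → (b ≡ d ⊎ S b d) × Star R c d
    step ε        s = -, inj₂ s , ε
    step (r ◅ rs) s with local r s
    ... | _ , inj₁ refl , rs₁ = -, inj₁ refl , rs₁ ◅◅ rs
    ... | _ , inj₂ s′   , rs₁ with step rs s′
    ...   | _ , s″ , rs₂ = -, s″ , rs₁ ◅◅ rs₂
    commute : Commute R S
    commute rs ε        = -, ε , rs
    commute rs (s ◅ ss) with step rs s
    ... | _ , s⁼ , rs₁ with commute rs₁ ss
    ...   | _ , ss₁ , rs₂ = -, optional s⁼ ◅◅ ss₁ , rs₂
      where
      optional : ∀ {b d} → b ≡ d ⊎ S b d → Star S b d
      optional (inj₁ refl) = ε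
      optional (inj₂ s)    = return s

  hindley-rosen : ∀ {R S : Rel A 0ℓ} →
    Confluent R → Confluent S → Commute R S → Confluent (R ∪ S)
  hindley-rosen {R} {S} confR confS commute =
    confluent-between inj-star Sum-star (diamond⇒confluent ◇)
    where
    ◇ : Diamond (Star R ∪ Star S)
    ◇ (inj₁ rs₁) (inj₁ rs₂) with confR rs₁ rs₂
    ... | _ , rs₃ , rs₄ = -, inj₁ rs₃ , inj₁ rs₄
    ◇ (inj₂ ss₁) (inj₂ ss₂) with confS ss₁ ss₂
    ... | _ , ss₃ , ss₄ = -, inj₂ ss₃ , inj₂ ss₄
    ◇ (inj₁ rs) (inj₂ ss) with commute rs ss
    ... | _ , ss′ , rs′ = -, inj₂ ss′ , inj₁ rs′
    ◇ (inj₂ ss) (inj₁ rs) with commute rs ss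
    ... | _ , ss′ , rs′ = -, inj₁ rs′ , inj₂ ss′
    inj-star : R ∪ S ⇒ Star R ∪ Star S
    inj-star (inj₁ r) = inj₁ (return r)
    inj-star (inj₂ s) = inj₂ (return s)
    Sum-star : Star R ∪ Star S ⇒ Star (R ∪ S)
    Sum-star (inj₁ rs) = map inj₁ rs
    Sum-star (inj₂ ss) = map inj₂ ss

  measure⇒sn⁺ : ∀ {R : Rel A 0ℓ} (f : A → ℕ) → (∀ {a b} → R a b → f b < f a) →
    StronglyNormalizing (Plus R)
  measure⇒sn⁺ {R} f decreasing =
    Subrelation.wellFounded plus-decreasing (On.wellFounded f <-wellFounded)
    where
    plus-decreasing : ∀ {a b} → Plus R b a → f a < f b
    plus-decreasing [ r ]⁺             = decreasing r
    plus-decreasing (_ ∼⁺⟨ rs ⟩ rs′) = <-trans (plus-decreasing rs′) (plus-decreasing rs)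

-- Shifting and substitution

shiftVar-comm : ∀ c c′ x → c ≤ c′ →
  shiftVar (suc c′) (shiftVar c x) ≡ shiftVar c (shiftVar c′ x)
shiftVar-comm zero    c′       x       _         = refl
shiftVar-comm (suc c) (suc c′) zero    _         = refl
shiftVar-comm (suc c) (suc c′) (suc x) (s≤s c≤c′) = cong suc (shiftVar-comm c c′ x c≤c′)

shift-comm : ∀ c c′ t → c ≤ c′ → shift (suc c′) (shift c t) ≡ shift c (shift c′ t)
shift-comm c c′ (var x)    c≤c′ = cong var (shiftVar-comm c c′ x c≤c′)
shift-comm c c′ (lam t)    c≤c′ = cong lam (shift-comm (suc c) (suc c′) t (s≤s c≤c′))
shift-comm c c′ (app t u)  c≤c′ =
  cong₂ app (shift-comm c c′ t c≤c′) (shift-comm c c′ u c≤c′)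
shift-comm c c′ (bang t)   c≤c′ = cong bang (shift-comm c c′ t c≤c′)
shift-comm c c′ (letb u t) c≤c′ =
  cong₂ letb (shift-comm c c′ u c≤c′) (shift-comm (suc c) (suc c′) t (s≤s c≤c′))

shift-shift0 : ∀ c t → shift (suc c) (shift 0 t) ≡ shift 0 (shift c t)
shift-shift0 c t = shift-comm 0 c t z≤n

varSubst-shiftVar : ∀ c x → varSubst c (shiftVar c x) ≡ just x
varSubst-shiftVar zero    x       = refl
varSubst-shiftVar (suc c) zero    = refl
varSubst-shiftVar (suc c) (suc x) = cong (Maybe.map suc) (varSubst-shiftVar c x)

subst-shift-cancel : ∀ c u t → subst c u (shift c t) ≡ t
subst-shift-cancel c u (var x)    = cong (maybe var u) (varSubst-shiftVar c x)
subst-shift-cancel c u (lam t)    = cong lam (subst-shift-cancel (suc c) (shift 0 u) t)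
subst-shift-cancel c u (app t s)  = cong₂ app (subst-shift-cancel c u t) (subst-shift-cancel c u s)
subst-shift-cancel c u (bang t)   = cong bang (subst-shift-cancel c u t)
subst-shift-cancel c u (letb s t) =
  cong₂ letb (subst-shift-cancel c u s) (subst-shift-cancel (suc c) (shift 0 u) t)

private
  map-suc-shiftVar : ∀ c (m : Maybe ℕ) →
    Maybe.map suc (Maybe.map (shiftVar c) m) ≡ Maybe.map (shiftVar (suc c)) (Maybe.map suc m)
  map-suc-shiftVar c nothing  = refl
  map-suc-shiftVar c (just x) = refl

  shift-substVar : ∀ c u (m : Maybe ℕ) →
    shift c (maybe var u m) ≡ maybe var (shift c u) (Maybe.map (shiftVar c) m)
  shift-substVar c u nothing  = refl
  shift-substVar c u (just x) = refl

varSubst-shiftVar-≤ : ∀ c j x → c ≤ j →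
  varSubst (suc j) (shiftVar c x) ≡ Maybe.map (shiftVar c) (varSubst j x)
varSubst-shiftVar-≤ zero    j       x       _         = refl
varSubst-shiftVar-≤ (suc c) (suc j) zero    _         = refl
varSubst-shiftVar-≤ (suc c) (suc j) (suc x) (s≤s c≤j) =
  trans (cong (Maybe.map suc) (varSubst-shiftVar-≤ c j x c≤j)) (map-suc-shiftVar c (varSubst j x))

varSubst-shiftVar-≥ : ∀ j c x → j ≤ c →
  varSubst j (shiftVar (suc c) x) ≡ Maybe.map (shiftVar c) (varSubst j x)
varSubst-shiftVar-≥ zero    c       zero    _         = refl
varSubst-shiftVar-≥ zero    c       (suc x) _         = refl
varSubst-shiftVar-≥ (suc j) (suc c) zero    _         = refl
varSubst-shiftVar-≥ (suc j) (suc c) (suc x) (s≤s j≤c) =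
  trans (cong (Maybe.map suc) (varSubst-shiftVar-≥ j c x j≤c)) (map-suc-shiftVar c (varSubst j x))

shift-subst-≤ : ∀ c j u t → c ≤ j →
  shift c (subst j u t) ≡ subst (suc j) (shift c u) (shift c t)
shift-subst-≤ c j u (var x) c≤j =
  trans (shift-substVar c u (varSubst j x))
        (sym (cong (maybe var (shift c u)) (varSubst-shiftVar-≤ c j x c≤j)))
shift-subst-≤ c j u (lam t) c≤j =
  cong lam (trans (shift-subst-≤ (suc c) (suc j) (shift 0 u) t (s≤s c≤j))
                  (cong (λ w → subst (suc (suc j)) w (shift (suc c) t)) (shift-shift0 c u)))
shift-subst-≤ c j u (app t s) c≤j =
  cong₂ app (shift-subst-≤ c j u t c≤j) (shift-subst-≤ c j u s c≤j)
shift-subst-≤ c j u (bang t) c≤j = cong bang (shift-subst-≤ c j u t c≤j)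
shift-subst-≤ c j u (letb s t) c≤j =
  cong₂ letb (shift-subst-≤ c j u s c≤j)
    (trans (shift-subst-≤ (suc c) (suc j) (shift 0 u) t (s≤s c≤j))
           (cong (λ w → subst (suc (suc j)) w (shift (suc c) t)) (shift-shift0 c u)))

shift-subst-≥ : ∀ c j u t → j ≤ c →
  shift c (subst j u t) ≡ subst j (shift c u) (shift (suc c) t)
shift-subst-≥ c j u (var x) j≤c =
  trans (shift-substVar c u (varSubst j x))
        (sym (cong (maybe var (shift c u)) (varSubst-shiftVar-≥ j c x j≤c)))
shift-subst-≥ c j u (lam t) j≤c =
  cong lam (trans (shift-subst-≥ (suc c) (suc j) (shift 0 u) t (s≤s j≤c))
                  (cong (λ w → subst (suc j) w (shift (suc (suc c)) t)) (shift-shift0 c u)))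
shift-subst-≥ c j u (app t s) j≤c =
  cong₂ app (shift-subst-≥ c j u t j≤c) (shift-subst-≥ c j u s j≤c)
shift-subst-≥ c j u (bang t) j≤c = cong bang (shift-subst-≥ c j u t j≤c)
shift-subst-≥ c j u (letb s t) j≤c =
  cong₂ letb (shift-subst-≥ c j u s j≤c)
    (trans (shift-subst-≥ (suc c) (suc j) (shift 0 u) t (s≤s j≤c))
           (cong (λ w → subst (suc j) w (shift (suc (suc c)) t)) (shift-shift0 c u)))

varSubst-< : ∀ {j x} → x < j → varSubst j x ≡ just x
varSubst-< {suc j} {zero}  _         = refl
varSubst-< {suc j} {suc x} (s≤s x<j) = cong (Maybe.map suc) (varSubst-< x<j)

varSubst-self : ∀ j → varSubst j j ≡ nothing
varSubst-self zero    = refl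
varSubst-self (suc j) = cong (Maybe.map suc) (varSubst-self j)

varSubst-> : ∀ {j x} → j ≤ x → varSubst j (suc x) ≡ just x
varSubst-> {zero}  _         = refl
varSubst-> {suc j} (s≤s j≤x) = cong (Maybe.map suc) (varSubst-> j≤x)

substVar-< : ∀ {j x} u → x < j → substVar j u x ≡ var x
substVar-< u x<j = cong (maybe var u) (varSubst-< x<j)

substVar-self : ∀ j u → substVar j u j ≡ u
substVar-self j u = cong (maybe var u) (varSubst-self j)

substVar-> : ∀ {j x} u → j ≤ x → substVar j u (suc x) ≡ var x
substVar-> u j≤x = cong (maybe var u) (varSubst-> j≤x)

substVar-subst : ∀ i j s u x → i ≤ j →
  subst j u (substVar i s x) ≡ subst i (subst j u s) (substVar (suc j) (shift i u) x)
substVar-subst i j s u x i≤j with <-cmp x i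
... | tri< x<i _ _ = begin
  subst j u (substVar i s x)        ≡⟨ cong (subst j u) (substVar-< s x<i) ⟩
  substVar j u x                    ≡⟨ substVar-< u (<-≤-trans x<i i≤j) ⟩
  var x                             ≡⟨ substVar-< (subst j u s) x<i ⟨
  substVar i (subst j u s) x
    ≡⟨ cong (subst i (subst j u s)) (substVar-< (shift i u) (<-≤-trans x<i (m≤n⇒m≤1+n i≤j))) ⟨
  subst i (subst j u s) (substVar (suc j) (shift i u) x) ∎
  where open ≡-Reasoning
... | tri≈ _ refl _ = begin
  subst j u (substVar x s x)        ≡⟨ cong (subst j u) (substVar-self x s) ⟩
  subst j u s                       ≡⟨ substVar-self x (subst j u s) ⟨
  substVar x (subst j u s) x
    ≡⟨ cong (subst x (subst j u s)) (substVar-< (shift x u) (s≤s i≤j)) ⟨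
  subst x (subst j u s) (substVar (suc j) (shift x u) x) ∎
  where open ≡-Reasoning
substVar-subst i j s u (suc x) i≤j | tri> _ _ (s≤s i≤x) with <-cmp x j
... | tri< x<j _ _ = begin
  subst j u (substVar i s (suc x))  ≡⟨ cong (subst j u) (substVar-> s i≤x) ⟩
  substVar j u x                    ≡⟨ substVar-< u x<j ⟩
  var x                             ≡⟨ substVar-> (subst j u s) i≤x ⟨
  substVar i (subst j u s) (suc x)
    ≡⟨ cong (subst i (subst j u s)) (substVar-< (shift i u) (s≤s x<j)) ⟨
  subst i (subst j u s) (substVar (suc j) (shift i u) (suc x)) ∎
  where open ≡-Reasoning
... | tri≈ _ refl _ = begin
  subst x u (substVar i s (suc x))  ≡⟨ cong (subst x u) (substVar-> s i≤x) ⟩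
  substVar x u x                    ≡⟨ substVar-self x u ⟩
  u                                 ≡⟨ subst-shift-cancel i (subst x u s) u ⟨
  subst i (subst x u s) (shift i u)
    ≡⟨ cong (subst i (subst x u s)) (substVar-self (suc x) (shift i u)) ⟨
  subst i (subst x u s) (substVar (suc x) (shift i u) (suc x)) ∎
  where open ≡-Reasoning
substVar-subst i j s u (suc (suc x)) i≤j | tri> _ _ (s≤s i≤1+x) | tri> _ _ (s≤s j≤x) = begin
  subst j u (substVar i s (suc (suc x)))  ≡⟨ cong (subst j u) (substVar-> s i≤1+x) ⟩
  substVar j u (suc x)                    ≡⟨ substVar-> u j≤x ⟩
  var x                                   ≡⟨ substVar-> (subst j u s) (≤-trans i≤j j≤x) ⟨
  substVar i (subst j u s) (suc x)
    ≡⟨ cong (subst i (subst j u s)) (substVar-> (shift i u) (s≤s j≤x)) ⟨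
  subst i (subst j u s) (substVar (suc j) (shift i u) (suc (suc x))) ∎
  where open ≡-Reasoning

subst-subst : ∀ i j s u t → i ≤ j →
  subst j u (subst i s t) ≡ subst i (subst j u s) (subst (suc j) (shift i u) t)

subst-subst-under-binder : ∀ i j s u t → i ≤ j →
  subst (suc j) (shift 0 u) (subst (suc i) (shift 0 s) t) ≡
  subst (suc i) (shift 0 (subst j u s)) (subst (suc (suc j)) (shift 0 (shift i u)) t)
subst-subst-under-binder i j s u t i≤j =
  trans (subst-subst (suc i) (suc j) (shift 0 s) (shift 0 u) t (s≤s i≤j))
        (cong₂ (λ s′ u′ → subst (suc i) s′ (subst (suc (suc j)) u′ t))
               (sym (shift-subst-≤ 0 j u s z≤n)) (shift-shift0 i u))

subst-subst i j s u (var x)    i≤j = substVar-subst i j s u x i≤j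
subst-subst i j s u (lam t)    i≤j = cong lam (subst-subst-under-binder i j s u t i≤j)
subst-subst i j s u (app t r)  i≤j = cong₂ app (subst-subst i j s u t i≤j) (subst-subst i j s u r i≤j)
subst-subst i j s u (bang t)   i≤j = cong bang (subst-subst i j s u t i≤j)
subst-subst i j s u (letb r t) i≤j =
  cong₂ letb (subst-subst i j s u r i≤j) (subst-subst-under-binder i j s u t i≤j)

-- Occurrence counts

-- boxed and unboxed split no into the occurrences inside and outside !-boxes;
-- TV t x holds iff boxed x t is positive.
boxed : ℕ → PTerm → ℕ
boxed x (var y)    = 0
boxed x (lam t)    = boxed (suc x) t
boxed x (app t u)  = boxed x t + boxed x u
boxed x (bang t)   = no x t
boxed x (letb u t) = boxed x u + boxed (suc x) t

unboxed : ℕ → PTerm → ℕ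
unboxed x (var y)    = eqℕ x y
unboxed x (lam t)    = unboxed (suc x) t
unboxed x (app t u)  = unboxed x t + unboxed x u
unboxed x (bang t)   = 0
unboxed x (letb u t) = unboxed x u + unboxed (suc x) t

no≡boxed+unboxed : ∀ x t → no x t ≡ boxed x t + unboxed x t
no≡boxed+unboxed x (var y)    = refl
no≡boxed+unboxed x (lam t)    = no≡boxed+unboxed (suc x) t
no≡boxed+unboxed x (app t u)  =
  trans (cong₂ _+_ (no≡boxed+unboxed x t) (no≡boxed+unboxed x u))
        (+-interchange (boxed x t) (unboxed x t) (boxed x u) (unboxed x u))
no≡boxed+unboxed x (bang t)   = sym (+-identityʳ (no x t))
no≡boxed+unboxed x (letb u t) =
  trans (cong₂ _+_ (no≡boxed+unboxed x u) (no≡boxed+unboxed (suc x) t))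
        (+-interchange (boxed x u) (unboxed x u) (boxed (suc x) t) (unboxed (suc x) t))

boxed≤no : ∀ x t → boxed x t ≤ no x t
boxed≤no x t = ≤-trans (m≤m+n _ _) (≤-reflexive (sym (no≡boxed+unboxed x t)))

unboxed≤no : ∀ x t → unboxed x t ≤ no x t
unboxed≤no x t = ≤-trans (m≤n+m _ _) (≤-reflexive (sym (no≡boxed+unboxed x t)))

eqℕ-refl : ∀ x → eqℕ x x ≡ 1
eqℕ-refl zero    = refl
eqℕ-refl (suc x) = eqℕ-refl x

eqℕ-shiftVar : ∀ c y x → eqℕ (shiftVar c y) (shiftVar c x) ≡ eqℕ y x
eqℕ-shiftVar zero    y       x       = refl
eqℕ-shiftVar (suc c) zero    zero    = refl
eqℕ-shiftVar (suc c) zero    (suc x) = refl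
eqℕ-shiftVar (suc c) (suc y) zero    = refl
eqℕ-shiftVar (suc c) (suc y) (suc x) = eqℕ-shiftVar c y x

eqℕ-cutoff-shiftVar : ∀ c x → eqℕ c (shiftVar c x) ≡ 0
eqℕ-cutoff-shiftVar zero    x       = refl
eqℕ-cutoff-shiftVar (suc c) zero    = refl
eqℕ-cutoff-shiftVar (suc c) (suc x) = eqℕ-cutoff-shiftVar c x

eqℕ-shiftVar-cutoff : ∀ c y → eqℕ (shiftVar c y) c ≡ 0
eqℕ-shiftVar-cutoff zero    y       = refl
eqℕ-shiftVar-cutoff (suc c) zero    = refl
eqℕ-shiftVar-cutoff (suc c) (suc y) = eqℕ-shiftVar-cutoff c y

no-shift : ∀ c y t → no (shiftVar c y) (shift c t) ≡ no y t
no-shift c y (var x)    = eqℕ-shiftVar c y x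
no-shift c y (lam t)    = no-shift (suc c) (suc y) t
no-shift c y (app t u)  = cong₂ _+_ (no-shift c y t) (no-shift c y u)
no-shift c y (bang t)   = no-shift c y t
no-shift c y (letb u t) = cong₂ _+_ (no-shift c y u) (no-shift (suc c) (suc y) t)

no-shift-cutoff : ∀ c t → no c (shift c t) ≡ 0
no-shift-cutoff c (var x)    = eqℕ-cutoff-shiftVar c x
no-shift-cutoff c (lam t)    = no-shift-cutoff (suc c) t
no-shift-cutoff c (app t u)  = cong₂ _+_ (no-shift-cutoff c t) (no-shift-cutoff c u)
no-shift-cutoff c (bang t)   = no-shift-cutoff c t
no-shift-cutoff c (letb u t) = cong₂ _+_ (no-shift-cutoff c u) (no-shift-cutoff (suc c) t)

boxed-shift : ∀ c y t → boxed (shiftVar c y) (shift c t) ≡ boxed y t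
boxed-shift c y (var x)    = refl
boxed-shift c y (lam t)    = boxed-shift (suc c) (suc y) t
boxed-shift c y (app t u)  = cong₂ _+_ (boxed-shift c y t) (boxed-shift c y u)
boxed-shift c y (bang t)   = no-shift c y t
boxed-shift c y (letb u t) = cong₂ _+_ (boxed-shift c y u) (boxed-shift (suc c) (suc y) t)

boxed-shift-cutoff : ∀ c t → boxed c (shift c t) ≡ 0
boxed-shift-cutoff c (var x)    = refl
boxed-shift-cutoff c (lam t)    = boxed-shift-cutoff (suc c) t
boxed-shift-cutoff c (app t u)  = cong₂ _+_ (boxed-shift-cutoff c t) (boxed-shift-cutoff c u)
boxed-shift-cutoff c (bang t)   = no-shift-cutoff c t
boxed-shift-cutoff c (letb u t) = cong₂ _+_ (boxed-shift-cutoff c u) (boxed-shift-cutoff (suc c) t)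

varSubst-nothing : ∀ j x → varSubst j x ≡ nothing → x ≡ j
varSubst-nothing zero    zero    _  = refl
varSubst-nothing (suc j) (suc x) eq with varSubst j x in eq′
... | nothing = cong suc (varSubst-nothing j x eq′)

varSubst-just : ∀ j x z → varSubst j x ≡ just z →
  eqℕ j x ≡ 0 × (∀ y → eqℕ (shiftVar j y) x ≡ eqℕ y z)
varSubst-just zero    (suc x) .x    refl = refl , λ y → refl
varSubst-just (suc j) zero    .zero refl = refl , λ { zero → refl ; (suc y) → refl }
varSubst-just (suc j) (suc x) z     eq with varSubst j x in eq′
varSubst-just (suc j) (suc x) .(suc z) refl | just z =
  proj₁ (varSubst-just j x z eq′) , λ { zero → refl ; (suc y) → proj₂ (varSubst-just j x z eq′) y }

private
  distrib-two : ∀ a b c d U → (a + b * U) + (c + d * U) ≡ (a + c) + (b + d) * U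
  distrib-two = solve 5 (λ a b c d U → (a :+ b :* U) :+ (c :+ d :* U)
                                    := (a :+ c) :+ (b :+ d) :* U) refl
    where open +-*-Solver

  distrib-three : ∀ a b c a′ b′ c′ U V →
    (a + b * U + c * V) + (a′ + b′ * U + c′ * V) ≡ (a + a′) + (b + b′) * U + (c + c′) * V
  distrib-three = solve 8 (λ a b c a′ b′ c′ U V →
    (a :+ b :* U :+ c :* V) :+ (a′ :+ b′ :* U :+ c′ :* V)
      := (a :+ a′) :+ (b :+ b′) :* U :+ (c :+ c′) :* V) refl
    where open +-*-Solver

no-subst : ∀ j u t y → no y (subst j u t) ≡ no (shiftVar j y) t + no j t * no y u
no-subst j u (var x) y with varSubst j x in eq
... | nothing rewrite varSubst-nothing j x eq | eqℕ-shiftVar-cutoff j y | eqℕ-refl j =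
  sym (+-identityʳ (no y u))
... | just z rewrite proj₁ (varSubst-just j x z eq) | proj₂ (varSubst-just j x z eq) y =
  sym (+-identityʳ _)
no-subst j u (lam t) y
  rewrite no-subst (suc j) (shift 0 u) t (suc y) | no-shift 0 y u = refl
no-subst j u (app t s) y rewrite no-subst j u t y | no-subst j u s y =
  distrib-two (no (shiftVar j y) t) (no j t) (no (shiftVar j y) s) (no j s) (no y u)
no-subst j u (bang t) y = no-subst j u t y
no-subst j u (letb s t) y
  rewrite no-subst j u s y | no-subst (suc j) (shift 0 u) t (suc y) | no-shift 0 y u =
  distrib-two (no (shiftVar j y) s) (no j s) (no (suc (shiftVar j y)) t) (no (suc j) t) (no y u)

boxed-subst : ∀ j u t y → boxed y (subst j u t) ≡
  boxed (shiftVar j y) t + boxed j t * no y u + unboxed j t * boxed y u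
boxed-subst j u (var x) y with varSubst j x in eq
... | nothing rewrite varSubst-nothing j x eq | eqℕ-refl j = sym (+-identityʳ (boxed y u))
... | just z rewrite proj₁ (varSubst-just j x z eq) = refl
boxed-subst j u (lam t) y
  rewrite boxed-subst (suc j) (shift 0 u) t (suc y) | no-shift 0 y u | boxed-shift 0 y u = refl
boxed-subst j u (app t s) y rewrite boxed-subst j u t y | boxed-subst j u s y =
  distrib-three (boxed (shiftVar j y) t) (boxed j t) (unboxed j t)
                (boxed (shiftVar j y) s) (boxed j s) (unboxed j s) (no y u) (boxed y u)
boxed-subst j u (bang t) y = trans (no-subst j u t y) (sym (+-identityʳ _))
boxed-subst j u (letb s t) y
  rewrite boxed-subst j u s y | boxed-subst (suc j) (shift 0 u) t (suc y)
        | no-shift 0 y u | boxed-shift 0 y u =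
  distrib-three (boxed (shiftVar j y) s) (boxed j s) (unboxed j s)
                (boxed (suc (shiftVar j y)) t) (boxed (suc j) t) (unboxed (suc j) t) (no y u) (boxed y u)

private
  ≡0-mono : ∀ {a b} → a ≤ b → b ≡ 0 → a ≡ 0
  ≡0-mono a≤b refl = n≤0⇒n≡0 a≤b

  *≡0-monoˡ : ∀ {a′ a} b → a′ ≤ a → a * b ≡ 0 → a′ * b ≡ 0
  *≡0-monoˡ b a′≤a = ≡0-mono (*-monoˡ-≤ b a′≤a)

  *≡0-monoʳ : ∀ a {b′ b} → b′ ≤ b → a * b ≡ 0 → a * b′ ≡ 0
  *≡0-monoʳ a b′≤b = ≡0-mono (*-monoʳ-≤ a b′≤b)

  *≡0-comm : ∀ a b → a * b ≡ 0 → b * a ≡ 0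
  *≡0-comm a b ab≡0 = trans (*-comm b a) ab≡0

  *≡0-transferˡ : ∀ {a a′} k → (a ≡ 0 → a′ ≡ 0) → a * k ≡ 0 → a′ * k ≡ 0
  *≡0-transferˡ {a} {a′} k f ak≡0 with m*n≡0⇒m≡0∨n≡0 a ak≡0
  ... | inj₁ a≡0 = cong (_* k) (f a≡0)
  ... | inj₂ refl = *-zeroʳ a′

  *≡0-transferʳ : ∀ k {a a′} → (a ≡ 0 → a′ ≡ 0) → k * a ≡ 0 → k * a′ ≡ 0
  *≡0-transferʳ k {a} {a′} f ka≡0 = *≡0-comm a′ k (*≡0-transferˡ k f (*≡0-comm k a ka≡0))

  +-*≡0 : ∀ a b c → a * c ≡ 0 → b * c ≡ 0 → (a + b) * c ≡ 0
  +-*≡0 a b c ac≡0 bc≡0 = trans (*-distribʳ-+ c a b) (cong₂ _+_ ac≡0 bc≡0)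

  *-+≡0 : ∀ a b c → a * b ≡ 0 → a * c ≡ 0 → a * (b + c) ≡ 0
  *-+≡0 a b c ab≡0 ac≡0 = trans (*-distribˡ-+ a b c) (cong₂ _+_ ab≡0 ac≡0)

  *≡0-extendʳ : ∀ a b c → a * c ≡ 0 → a * (b * c) ≡ 0
  *≡0-extendʳ a b c ac≡0 = trans (x∙yz≈y∙xz a b c) (trans (cong (b *_) ac≡0) (*-zeroʳ b))

  *≡0-extendˡ : ∀ a b c → b * c ≡ 0 → (a * b) * c ≡ 0
  *≡0-extendˡ a b c bc≡0 = trans (*-assoc a b c) (trans (cong (a *_) bc≡0) (*-zeroʳ a))

  *≡0-extend : ∀ a b c d → a * c ≡ 0 → (a * b) * (c * d) ≡ 0
  *≡0-extend a b c d ac≡0 = trans (*-interchange a b c d) (cong (_* (b * d)) ac≡0)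

  expansion≡0 : ∀ A B C U V E D →
    A * E ≡ 0 → A * U ≡ 0 → (B * U) * E ≡ 0 → (B * U) * (D * U) ≡ 0 →
    (C * V) * E ≡ 0 → (C * V) * (D * U) ≡ 0 → (A + B * U + C * V) * (E + D * U) ≡ 0
  expansion≡0 A B C U V E D AE AU BUE BUDU CVE CVDU =
    +-*≡0 (A + B * U) (C * V) (E + D * U)
      (+-*≡0 A (B * U) (E + D * U) (*-+≡0 A E (D * U) AE (*≡0-extendʳ A D U AU))
                                   (*-+≡0 (B * U) E (D * U) BUE BUDU))
      (*-+≡0 (C * V) E (D * U) CVE CVDU)

  +≤1⇒*≡0 : ∀ a b → a + b ≤ 1 → a * b ≡ 0
  +≤1⇒*≡0 zero          b       _         = refl
  +≤1⇒*≡0 (suc a)       zero    _         = *-zeroʳ (suc a)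
  +≤1⇒*≡0 (suc zero)    (suc b) (s≤s ())
  +≤1⇒*≡0 (suc (suc a)) (suc b) (s≤s ())

-- Subject reduction

-- IsTerm with TV t x read as 1 ≤ boxed x t and FV t x as 1 ≤ no x t, so that
-- the disjointness side conditions become vanishing products of counts.
data IsTerm′ : PTerm → Set where
  var  : ∀ x → IsTerm′ (var x)
  lam  : ∀ {t} → IsTerm′ t → boxed 0 t ≡ 0 → no 0 t ≤ 1 → IsTerm′ (lam t)
  app  : ∀ {t u} → IsTerm′ t → IsTerm′ u
       → (∀ x → boxed x t * no x u ≡ 0)
       → (∀ x → no x t * boxed x u ≡ 0)
       → IsTerm′ (app t u)
  bang : ∀ {t} → IsTerm′ t → (∀ x → boxed x t ≡ 0) → (∀ x → no x t ≤ 1) → IsTerm′ (bang t)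
  letb : ∀ {u t} → IsTerm′ u → IsTerm′ t
       → (∀ x → boxed x u * no (suc x) t ≡ 0)
       → (∀ x → no x u * boxed (suc x) t ≡ 0)
       → IsTerm′ (letb u t)

shiftVar-elim : ∀ c {P : ℕ → Set} → P c → (∀ y → P (shiftVar c y)) → ∀ x → P x
shiftVar-elim zero    Pc P↑ zero    = Pc
shiftVar-elim zero    Pc P↑ (suc x) = P↑ x
shiftVar-elim (suc c) Pc P↑ zero    = P↑ zero
shiftVar-elim (suc c) {P} Pc P↑ (suc x) =
  shiftVar-elim c {λ y → P (suc y)} Pc (λ y → P↑ (suc y)) x

IsTerm′-shift : ∀ c {t} → IsTerm′ t → IsTerm′ (shift c t)
IsTerm′-shift c (var x) = var (shiftVar c x)
IsTerm′-shift c {lam t} (lam T b0 n≤1) =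
  lam (IsTerm′-shift (suc c) T) (trans (boxed-shift (suc c) 0 t) b0)
      (≤-trans (≤-reflexive (no-shift (suc c) 0 t)) n≤1)
IsTerm′-shift c {app t u} (app T U d₁ d₂) =
  app (IsTerm′-shift c T) (IsTerm′-shift c U)
      (shiftVar-elim c (cong (_* no c (shift c u)) (boxed-shift-cutoff c t))
        λ y → trans (cong₂ _*_ (boxed-shift c y t) (no-shift c y u)) (d₁ y))
      (shiftVar-elim c (cong (_* boxed c (shift c u)) (no-shift-cutoff c t))
        λ y → trans (cong₂ _*_ (no-shift c y t) (boxed-shift c y u)) (d₂ y))
IsTerm′-shift c {bang t} (bang T b0 n≤1) =
  bang (IsTerm′-shift c T)
       (shiftVar-elim c (boxed-shift-cutoff c t) λ y → trans (boxed-shift c y t) (b0 y))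
       (shiftVar-elim c (≤-trans (≤-reflexive (no-shift-cutoff c t)) z≤n)
         λ y → ≤-trans (≤-reflexive (no-shift c y t)) (n≤1 y))
IsTerm′-shift c {letb u t} (letb U T d₁ d₂) =
  letb (IsTerm′-shift c U) (IsTerm′-shift (suc c) T)
       (shiftVar-elim c (cong (_* no (suc c) (shift (suc c) t)) (boxed-shift-cutoff c u))
         λ y → trans (cong₂ _*_ (boxed-shift c y u) (no-shift (suc c) (suc y) t)) (d₁ y))
       (shiftVar-elim c (cong (_* boxed (suc c) (shift (suc c) t)) (no-shift-cutoff c u))
         λ y → trans (cong₂ _*_ (no-shift c y u) (boxed-shift (suc c) (suc y) t)) (d₂ y))

record _≼_ (t′ t : PTerm) : Set where
  field
    boxed-≤ : ∀ x → boxed x t′ ≤ boxed x t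
    no-≤    : ∀ x → no x t′ ≤ no x t
open _≼_

≼-appˡ : ∀ t u → t ≼ app t u
≼-appˡ t u = record { boxed-≤ = λ x → m≤m+n _ _ ; no-≤ = λ x → m≤m+n _ _ }

≼-appʳ : ∀ t u → u ≼ app t u
≼-appʳ t u = record { boxed-≤ = λ x → m≤n+m _ _ ; no-≤ = λ x → m≤n+m _ _ }

≼-app-swap : ∀ t u → app u t ≼ app t u
≼-app-swap t u = record { boxed-≤ = λ x → ≤-reflexive (+-comm (boxed x u) (boxed x t))
                        ; no-≤    = λ x → ≤-reflexive (+-comm (no x u) (no x t)) }

≼-bang : ∀ t → t ≼ bang t
≼-bang t = record { boxed-≤ = λ x → boxed≤no x t ; no-≤ = λ x → ≤-refl }

≼-letb-app : ∀ u t → app u (lam t) ≼ letb u t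
≼-letb-app u t = record { boxed-≤ = λ x → ≤-refl ; no-≤ = λ x → ≤-refl }

-- The two ways a substitution arises: from a β-redex, with j linear and unboxed
-- in t, and from a bang-redex, with u the contents of a box.
data Substitutable (j : ℕ) (u t : PTerm) : Set where
  linear : IsTerm′ u → boxed j t ≡ 0 → no j t ≤ 1
         → (∀ y → boxed (shiftVar j y) t * no y u ≡ 0)
         → (∀ y → no (shiftVar j y) t * boxed y u ≡ 0)
         → Substitutable j u t
  box    : IsTerm′ u → (∀ y → boxed y u ≡ 0) → (∀ y → no y u ≤ 1)
         → (∀ y → no y u * no (shiftVar j y) t ≡ 0)
         → Substitutable j u t

Substitutable-mono : ∀ {j u t t′} → t′ ≼ t → Substitutable j u t → Substitutable j u t′
Substitutable-mono {j} {u} le (linear U b0 n≤1 d₁ d₂) =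
  linear U (≡0-mono (boxed-≤ le j) b0) (≤-trans (no-≤ le j) n≤1)
         (λ y → *≡0-monoˡ (no y u) (boxed-≤ le (shiftVar j y)) (d₁ y))
         (λ y → *≡0-monoˡ (boxed y u) (no-≤ le (shiftVar j y)) (d₂ y))
Substitutable-mono {j} {u} le (box U b0 n≤1 d) =
  box U b0 n≤1 (λ y → *≡0-monoʳ (no y u) (no-≤ le (shiftVar j y)) (d y))

Substitutable-under-binder : ∀ {j u t} →
  Substitutable j u (lam t) → Substitutable (suc j) (shift 0 u) t
Substitutable-under-binder {j} {u} {t} (linear U b0 n≤1 d₁ d₂) =
  linear (IsTerm′-shift 0 U) b0 n≤1 d₁′ d₂′
  where
  d₁′ : ∀ y → boxed (shiftVar (suc j) y) t * no y (shift 0 u) ≡ 0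
  d₁′ zero    = trans (cong (boxed 0 t *_) (no-shift-cutoff 0 u)) (*-zeroʳ (boxed 0 t))
  d₁′ (suc y) = trans (cong (boxed (suc (shiftVar j y)) t *_) (no-shift 0 y u)) (d₁ y)
  d₂′ : ∀ y → no (shiftVar (suc j) y) t * boxed y (shift 0 u) ≡ 0
  d₂′ zero    = trans (cong (no 0 t *_) (boxed-shift-cutoff 0 u)) (*-zeroʳ (no 0 t))
  d₂′ (suc y) = trans (cong (no (suc (shiftVar j y)) t *_) (boxed-shift 0 y u)) (d₂ y)
Substitutable-under-binder {j} {u} {t} (box U b0 n≤1 d) =
  box (IsTerm′-shift 0 U)
      (shiftVar-elim 0 (boxed-shift-cutoff 0 u) λ y → trans (boxed-shift 0 y u) (b0 y))
      (shiftVar-elim 0 (≤-trans (≤-reflexive (no-shift-cutoff 0 u)) z≤n)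
                       λ y → ≤-trans (≤-reflexive (no-shift 0 y u)) (n≤1 y))
      d′
  where
  d′ : ∀ y → no y (shift 0 u) * no (shiftVar (suc j) y) t ≡ 0
  d′ zero    = cong (_* no 0 t) (no-shift-cutoff 0 u)
  d′ (suc y) = trans (cong (_* no (suc (shiftVar j y)) t) (no-shift 0 y u)) (d y)

subst-disjoint : ∀ {j u t₁ t₂} → Substitutable j u (app t₁ t₂) →
  (∀ x → boxed x t₁ * no x t₂ ≡ 0) →
  ∀ y → boxed y (subst j u t₁) * no y (subst j u t₂) ≡ 0
subst-disjoint {j} {u} {t₁} {t₂} H d y rewrite boxed-subst j u t₁ y | no-subst j u t₂ y = vanish H
  where
  A = boxed (shiftVar j y) t₁
  B = boxed j t₁
  C = unboxed j t₁
  U = no y u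
  V = boxed y u
  E = no (shiftVar j y) t₂
  D = no j t₂
  AE : A * E ≡ 0
  AE = d (shiftVar j y)
  vanish : Substitutable j u (app t₁ t₂) → (A + B * U + C * V) * (E + D * U) ≡ 0
  vanish (linear _ b0 n≤1 d₁ d₂) = expansion≡0 A B C U V E D AE AU BUE BUDU CVE CVDU
    where
    B≡0 : B ≡ 0
    B≡0 = m+n≡0⇒m≡0 B b0
    AU : A * U ≡ 0
    AU = *≡0-monoˡ U (m≤m+n A _) (d₁ y)
    BUE : (B * U) * E ≡ 0
    BUE = cong (λ b → b * U * E) B≡0
    BUDU : (B * U) * (D * U) ≡ 0
    BUDU = cong (λ b → b * U * (D * U)) B≡0
    CVE : (C * V) * E ≡ 0
    CVE = *≡0-extendˡ C V E (*≡0-comm E V (*≡0-monoˡ V (m≤n+m E (no (shiftVar j y) t₁)) (d₂ y)))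
    CVDU : (C * V) * (D * U) ≡ 0
    CVDU = *≡0-extend C V D U (*≡0-monoˡ D (unboxed≤no j t₁) (+≤1⇒*≡0 (no j t₁) D n≤1))
  vanish (box _ b0 _ d′) = expansion≡0 A B C U V E D AE AU BUE BUDU CVE CVDU
    where
    AU : A * U ≡ 0
    AU = *≡0-comm U A (*≡0-monoʳ U (≤-trans (boxed≤no _ t₁) (m≤m+n _ _)) (d′ y))
    BUE : (B * U) * E ≡ 0
    BUE = *≡0-extendˡ B U E (*≡0-monoʳ U (m≤n+m E (no (shiftVar j y) t₁)) (d′ y))
    BUDU : (B * U) * (D * U) ≡ 0
    BUDU = *≡0-extend B U D U (d j)
    CVE : (C * V) * E ≡ 0
    CVE = *≡0-extendˡ C V E (cong (_* E) (b0 y))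
    CVDU : (C * V) * (D * U) ≡ 0
    CVDU = *≡0-extendˡ C V (D * U) (cong (_* (D * U)) (b0 y))

no-subst-under-binder : ∀ j u t → no 0 (subst (suc j) (shift 0 u) t) ≡ no 0 t
no-subst-under-binder j u t = begin
  no 0 (subst (suc j) (shift 0 u) t)
    ≡⟨ no-subst (suc j) (shift 0 u) t 0 ⟩
  no 0 t + no (suc j) t * no 0 (shift 0 u)
    ≡⟨ cong (λ n → no 0 t + no (suc j) t * n) (no-shift-cutoff 0 u) ⟩
  no 0 t + no (suc j) t * 0
    ≡⟨ cong (no 0 t +_) (*-zeroʳ (no (suc j) t)) ⟩
  no 0 t + 0
    ≡⟨ +-identityʳ (no 0 t) ⟩
  no 0 t ∎
  where open ≡-Reasoning

boxed-subst-under-binder : ∀ j u t → boxed 0 (subst (suc j) (shift 0 u) t) ≡ boxed 0 t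
boxed-subst-under-binder j u t = begin
  boxed 0 (subst (suc j) (shift 0 u) t)
    ≡⟨ boxed-subst (suc j) (shift 0 u) t 0 ⟩
  boxed 0 t + boxed (suc j) t * no 0 (shift 0 u) + unboxed (suc j) t * boxed 0 (shift 0 u)
    ≡⟨ cong₂ (λ m n → boxed 0 t + boxed (suc j) t * m + unboxed (suc j) t * n)
             (no-shift-cutoff 0 u) (boxed-shift-cutoff 0 u) ⟩
  boxed 0 t + boxed (suc j) t * 0 + unboxed (suc j) t * 0
    ≡⟨ cong₂ (λ m n → boxed 0 t + m + n) (*-zeroʳ (boxed (suc j) t))
                                            (*-zeroʳ (unboxed (suc j) t)) ⟩
  boxed 0 t + 0 + 0
    ≡⟨ trans (+-identityʳ _) (+-identityʳ _) ⟩
  boxed 0 t ∎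
  where open ≡-Reasoning

subst-disjoint′ : ∀ {j u t₁ t₂} → Substitutable j u (app t₁ t₂) →
  (∀ x → no x t₁ * boxed x t₂ ≡ 0) →
  ∀ y → no y (subst j u t₁) * boxed y (subst j u t₂) ≡ 0
subst-disjoint′ {j} {u} {t₁} {t₂} H d y =
  *≡0-comm (boxed y (subst j u t₂)) (no y (subst j u t₁))
    (subst-disjoint (Substitutable-mono (≼-app-swap t₁ t₂) H)
                    (λ x → *≡0-comm (no x t₁) (boxed x t₂) (d x)) y)

boxed-subst≡0 : ∀ {j u t} → Substitutable j u (bang t) → (∀ x → boxed x t ≡ 0) →
  ∀ y → boxed y (subst j u t) ≡ 0
boxed-subst≡0 {j} {u} {t} H b0 y = begin
  boxed y (subst j u t)
    ≡⟨ boxed-subst j u t y ⟩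
  boxed (shiftVar j y) t + boxed j t * no y u + unboxed j t * boxed y u
    ≡⟨ cong₂ (λ a b → a + b * no y u + unboxed j t * boxed y u) (b0 (shiftVar j y)) (b0 j) ⟩
  unboxed j t * boxed y u
    ≡⟨ unboxed-j-or-boxed-y H ⟩
  0 ∎
  where
  open ≡-Reasoning
  unboxed-j-or-boxed-y : Substitutable j u (bang t) → unboxed j t * boxed y u ≡ 0
  unboxed-j-or-boxed-y (linear _ no-j≡0 _ _ _) = cong (_* boxed y u) (≡0-mono (unboxed≤no j t) no-j≡0)
  unboxed-j-or-boxed-y (box _ b0u _ _) = trans (cong (unboxed j t *_) (b0u y)) (*-zeroʳ (unboxed j t))

no-subst≤1 : ∀ {j u t} → Substitutable j u (bang t) → (∀ x → no x t ≤ 1) →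
  ∀ y → no y (subst j u t) ≤ 1
no-subst≤1 {j} {u} {t} H n≤1 y rewrite no-subst j u t y = bound H
  where
  bound : Substitutable j u (bang t) → no (shiftVar j y) t + no j t * no y u ≤ 1
  bound (linear _ no-j≡0 _ _ _) rewrite no-j≡0 | +-identityʳ (no (shiftVar j y) t) = n≤1 (shiftVar j y)
  bound (box _ _ n≤1u d) with m*n≡0⇒m≡0∨n≡0 (no y u) (d y)
  ... | inj₁ no-y≡0 rewrite no-y≡0 | *-zeroʳ (no j t) | +-identityʳ (no (shiftVar j y) t) =
    n≤1 (shiftVar j y)
  ... | inj₂ no-↑y≡0 rewrite no-↑y≡0 = *-mono-≤ (n≤1 j) (n≤1u y)

IsTerm′-subst : ∀ {j u t} → IsTerm′ t → Substitutable j u t → IsTerm′ (subst j u t)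
IsTerm′-subst {j} {u} {var x} (var x) H with varSubst j x
... | just z = var z
... | nothing with H
...   | linear U _ _ _ _ = U
...   | box U _ _ _ = U
IsTerm′-subst {j} {u} {lam t} (lam T b0 n≤1) H =
  lam (IsTerm′-subst T (Substitutable-under-binder H))
      (trans (boxed-subst-under-binder j u t) b0)
      (≤-trans (≤-reflexive (no-subst-under-binder j u t)) n≤1)
IsTerm′-subst {j} {u} {app t₁ t₂} (app T₁ T₂ d₁ d₂) H =
  app (IsTerm′-subst T₁ (Substitutable-mono (≼-appˡ t₁ t₂) H))
      (IsTerm′-subst T₂ (Substitutable-mono (≼-appʳ t₁ t₂) H))
      (subst-disjoint H d₁) (subst-disjoint′ H d₂)
IsTerm′-subst {j} {u} {bang t} (bang T b0 n≤1) H =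
  bang (IsTerm′-subst T (Substitutable-mono (≼-bang t) H)) (boxed-subst≡0 H b0) (no-subst≤1 H n≤1)
IsTerm′-subst {j} {u} {letb s t} (letb S T d₁ d₂) H =
  letb (IsTerm′-subst S (Substitutable-mono (≼-appˡ s (lam t)) Hₐ))
       (IsTerm′-subst T (Substitutable-under-binder (Substitutable-mono (≼-appʳ s (lam t)) Hₐ)))
       (subst-disjoint Hₐ d₁) (subst-disjoint′ Hₐ d₂)
  where
  Hₐ : Substitutable j u (app s (lam t))
  Hₐ = Substitutable-mono (≼-letb-app s t) H

IsTerm′-β : ∀ {t u} → IsTerm′ (app (lam t) u) → IsTerm′ (t [ u ])
IsTerm′-β (app (lam T b0 n≤1) U d₁ d₂) = IsTerm′-subst T (linear U b0 n≤1 d₁ d₂)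

IsTerm′-!β : ∀ {u t} → IsTerm′ (letb (bang u) t) → IsTerm′ (t [ u ])
IsTerm′-!β (letb (bang U b0 n≤1) T d₁ d₂) = IsTerm′-subst T (box U b0 n≤1 d₁)

IsTerm′-com1 : ∀ {t₁ t₂ t₃} → IsTerm′ (letb (letb t₁ t₂) t₃) →
  IsTerm′ (letb t₁ (letb t₂ (shift 1 t₃)))
IsTerm′-com1 {t₁} {t₂} {t₃} (letb (letb T₁ T₂ d₁ d₂) T₃ d₃ d₄) =
  letb T₁ (letb T₂ (IsTerm′-shift 1 T₃) d₂₃ d₂₃′) d₁₂₃ d₁₂₃′
  where
  d₂₃ : ∀ x → boxed x t₂ * no (suc x) (shift 1 t₃) ≡ 0
  d₂₃ zero    = trans (cong (boxed 0 t₂ *_) (no-shift-cutoff 1 t₃)) (*-zeroʳ (boxed 0 t₂))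
  d₂₃ (suc x) = trans (cong (boxed (suc x) t₂ *_) (no-shift 1 (suc x) t₃))
                      (*≡0-monoˡ (no (suc x) t₃) (m≤n+m _ (boxed x t₁)) (d₃ x))
  d₂₃′ : ∀ x → no x t₂ * boxed (suc x) (shift 1 t₃) ≡ 0
  d₂₃′ zero    = trans (cong (no 0 t₂ *_) (boxed-shift-cutoff 1 t₃)) (*-zeroʳ (no 0 t₂))
  d₂₃′ (suc x) = trans (cong (no (suc x) t₂ *_) (boxed-shift 1 (suc x) t₃))
                       (*≡0-monoˡ (boxed (suc x) t₃) (m≤n+m _ (no x t₁)) (d₄ x))
  d₁₂₃ : ∀ x → boxed x t₁ * (no (suc x) t₂ + no (suc (suc x)) (shift 1 t₃)) ≡ 0
  d₁₂₃ x rewrite no-shift 1 (suc x) t₃ =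
    *-+≡0 (boxed x t₁) _ _ (d₁ x)
      (*≡0-monoˡ (no (suc x) t₃) (m≤m+n (boxed x t₁) (boxed (suc x) t₂)) (d₃ x))
  d₁₂₃′ : ∀ x → no x t₁ * (boxed (suc x) t₂ + boxed (suc (suc x)) (shift 1 t₃)) ≡ 0
  d₁₂₃′ x rewrite boxed-shift 1 (suc x) t₃ =
    *-+≡0 (no x t₁) _ _ (d₂ x)
      (*≡0-monoˡ (boxed (suc x) t₃) (m≤m+n (no x t₁) (no (suc x) t₂)) (d₄ x))

IsTerm′-com2 : ∀ {t₁ t₂ t₃} → IsTerm′ (app (letb t₁ t₂) t₃) →
  IsTerm′ (letb t₁ (app t₂ (shift 0 t₃)))
IsTerm′-com2 {t₁} {t₂} {t₃} (app (letb T₁ T₂ d₁ d₂) T₃ d₃ d₄) =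
  letb T₁ (app T₂ (IsTerm′-shift 0 T₃) d₂₃ d₂₃′) d₁₂₃ d₁₂₃′
  where
  d₂₃ : ∀ x → boxed x t₂ * no x (shift 0 t₃) ≡ 0
  d₂₃ zero    = trans (cong (boxed 0 t₂ *_) (no-shift-cutoff 0 t₃)) (*-zeroʳ (boxed 0 t₂))
  d₂₃ (suc x) = trans (cong (boxed (suc x) t₂ *_) (no-shift 0 x t₃))
                      (*≡0-monoˡ (no x t₃) (m≤n+m _ (boxed x t₁)) (d₃ x))
  d₂₃′ : ∀ x → no x t₂ * boxed x (shift 0 t₃) ≡ 0
  d₂₃′ zero    = trans (cong (no 0 t₂ *_) (boxed-shift-cutoff 0 t₃)) (*-zeroʳ (no 0 t₂))
  d₂₃′ (suc x) = trans (cong (no (suc x) t₂ *_) (boxed-shift 0 x t₃))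
                       (*≡0-monoˡ (boxed x t₃) (m≤n+m _ (no x t₁)) (d₄ x))
  d₁₂₃ : ∀ x → boxed x t₁ * (no (suc x) t₂ + no (suc x) (shift 0 t₃)) ≡ 0
  d₁₂₃ x rewrite no-shift 0 x t₃ =
    *-+≡0 (boxed x t₁) _ _ (d₁ x)
      (*≡0-monoˡ (no x t₃) (m≤m+n (boxed x t₁) (boxed (suc x) t₂)) (d₃ x))
  d₁₂₃′ : ∀ x → no x t₁ * (boxed (suc x) t₂ + boxed (suc x) (shift 0 t₃)) ≡ 0
  d₁₂₃′ x rewrite boxed-shift 0 x t₃ =
    *-+≡0 (no x t₁) _ _ (d₂ x)
      (*≡0-monoˡ (boxed x t₃) (m≤m+n (no x t₁) (no (suc x) t₂)) (d₄ x))

-- What a step inside a subterm must preserve for the side conditions of the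
-- enclosing term to survive it.
record UnboxedStable (t t′ : PTerm) : Set where
  field
    boxed≡0 : ∀ x → boxed x t ≡ 0 → boxed x t′ ≡ 0
    no-≤    : ∀ x → boxed x t ≡ 0 → no x t′ ≤ no x t
open UnboxedStable

UnboxedStable-no≡0 : ∀ {t t′} → UnboxedStable t t′ → ∀ x → no x t ≡ 0 → no x t′ ≡ 0
UnboxedStable-no≡0 {t} st x no≡0 = ≡0-mono (no-≤ st x (≡0-mono (boxed≤no x t) no≡0)) no≡0

UnboxedStable-≡ : ∀ {t t′} → (∀ x → boxed x t′ ≡ boxed x t) → (∀ x → no x t′ ≡ no x t) →
  UnboxedStable t t′
UnboxedStable-≡ b≡ n≡ = record
  { boxed≡0 = λ x → trans (b≡ x)
  ; no-≤    = λ x _ → ≤-reflexive (n≡ x) }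

step-unboxed-stable : ∀ {t t′} → IsTerm′ t → t ⟶ t′ → UnboxedStable t t′
step-unboxed-stable {app (lam s) u} (app (lam _ b0 n≤1) _ _ _) β =
  record { boxed≡0 = boxed≡0′ ; no-≤ = λ x _ → no≤ x }
  where
  boxed≡0′ : ∀ x → boxed (suc x) s + boxed x u ≡ 0 → boxed x (s [ u ]) ≡ 0
  boxed≡0′ x e rewrite boxed-subst 0 u s x | b0 | m+n≡0⇒m≡0 (boxed (suc x) s) e
                     | m+n≡0⇒n≡0 (boxed (suc x) s) e = *-zeroʳ (unboxed 0 s)
  no≤ : ∀ x → no x (s [ u ]) ≤ no (suc x) s + no x u
  no≤ x rewrite no-subst 0 u s x =
    +-monoʳ-≤ (no (suc x) s) (≤-trans (*-monoˡ-≤ (no x u) n≤1) (≤-reflexive (*-identityˡ (no x u))))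
step-unboxed-stable {letb (bang u) s} _ !β = record { boxed≡0 = boxed≡0′ ; no-≤ = no≤ }
  where
  boxed≡0′ : ∀ x → no x u + boxed (suc x) s ≡ 0 → boxed x (s [ u ]) ≡ 0
  boxed≡0′ x e rewrite boxed-subst 0 u s x | m+n≡0⇒m≡0 (no x u) e | m+n≡0⇒n≡0 (no x u) e
                     | ≡0-mono (boxed≤no x u) (m+n≡0⇒m≡0 (no x u) e) | *-zeroʳ (boxed 0 s) =
    *-zeroʳ (unboxed 0 s)
  no≤ : ∀ x → no x u + boxed (suc x) s ≡ 0 → no x (s [ u ]) ≤ no x u + no (suc x) s
  no≤ x e rewrite no-subst 0 u s x | m+n≡0⇒m≡0 (no x u) e | *-zeroʳ (no 0 s) =
    ≤-reflexive (+-identityʳ (no (suc x) s))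
step-unboxed-stable {letb (letb t₁ t₂) t₃} _ com1 = UnboxedStable-≡ boxed≡ no≡
  where
  boxed≡ : ∀ x → boxed x (letb t₁ (letb t₂ (shift 1 t₃))) ≡ boxed x (letb (letb t₁ t₂) t₃)
  boxed≡ x rewrite boxed-shift 1 (suc x) t₃ = sym (+-assoc (boxed x t₁) _ _)
  no≡ : ∀ x → no x (letb t₁ (letb t₂ (shift 1 t₃))) ≡ no x (letb (letb t₁ t₂) t₃)
  no≡ x rewrite no-shift 1 (suc x) t₃ = sym (+-assoc (no x t₁) _ _)
step-unboxed-stable {app (letb t₁ t₂) t₃} _ com2 = UnboxedStable-≡ boxed≡ no≡
  where
  boxed≡ : ∀ x → boxed x (letb t₁ (app t₂ (shift 0 t₃))) ≡ boxed x (app (letb t₁ t₂) t₃)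
  boxed≡ x rewrite boxed-shift 0 x t₃ = sym (+-assoc (boxed x t₁) _ _)
  no≡ : ∀ x → no x (letb t₁ (app t₂ (shift 0 t₃))) ≡ no x (app (letb t₁ t₂) t₃)
  no≡ x rewrite no-shift 0 x t₃ = sym (+-assoc (no x t₁) _ _)
step-unboxed-stable (lam T _ _) (ξlam s) =
  record { boxed≡0 = λ x → boxed≡0 st (suc x) ; no-≤ = λ x → no-≤ st (suc x) }
  where st = step-unboxed-stable T s
step-unboxed-stable {app t u} (app T _ _ _) (ξappl s) = record
  { boxed≡0 = λ x e → trans (cong (_+ boxed x u) (boxed≡0 st x (m+n≡0⇒m≡0 _ e))) (m+n≡0⇒n≡0 _ e)
  ; no-≤    = λ x e → +-monoˡ-≤ (no x u) (no-≤ st x (m+n≡0⇒m≡0 _ e)) }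
  where st = step-unboxed-stable T s
step-unboxed-stable {app t u} (app _ U _ _) (ξappr s) = record
  { boxed≡0 = λ x e → trans (cong (boxed x t +_) (boxed≡0 st x (m+n≡0⇒n≡0 (boxed x t) e)))
                            (trans (+-identityʳ _) (m+n≡0⇒m≡0 _ e))
  ; no-≤    = λ x e → +-monoʳ-≤ (no x t) (no-≤ st x (m+n≡0⇒n≡0 (boxed x t) e)) }
  where st = step-unboxed-stable U s
step-unboxed-stable {bang t} (bang T _ _) (ξbang s) = record
  { boxed≡0 = λ x e → ≡0-mono (no-≤ st x (≡0-mono (boxed≤no x t) e)) e
  ; no-≤    = λ x e → no-≤ st x (≡0-mono (boxed≤no x t) e) }
  where st = step-unboxed-stable T s
step-unboxed-stable {letb u t} (letb U _ _ _) (ξletl s) = record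
  { boxed≡0 = λ x e → trans (cong (_+ boxed (suc x) t) (boxed≡0 st x (m+n≡0⇒m≡0 _ e))) (m+n≡0⇒n≡0 _ e)
  ; no-≤    = λ x e → +-monoˡ-≤ (no (suc x) t) (no-≤ st x (m+n≡0⇒m≡0 _ e)) }
  where st = step-unboxed-stable U s
step-unboxed-stable {letb u t} (letb _ T _ _) (ξletr s) = record
  { boxed≡0 = λ x e → trans (cong (boxed x u +_) (boxed≡0 st (suc x) (m+n≡0⇒n≡0 (boxed x u) e)))
                            (trans (+-identityʳ _) (m+n≡0⇒m≡0 _ e))
  ; no-≤    = λ x e → +-monoʳ-≤ (no x u) (no-≤ st (suc x) (m+n≡0⇒n≡0 (boxed x u) e)) }
  where st = step-unboxed-stable T s

IsTerm′-step : ∀ {t t′} → IsTerm′ t → t ⟶ t′ → IsTerm′ t′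
IsTerm′-step T β    = IsTerm′-β T
IsTerm′-step T !β   = IsTerm′-!β T
IsTerm′-step T com1 = IsTerm′-com1 T
IsTerm′-step T com2 = IsTerm′-com2 T
IsTerm′-step (lam T b0 n≤1) (ξlam s) =
  lam (IsTerm′-step T s) (boxed≡0 st 0 b0) (≤-trans (no-≤ st 0 b0) n≤1)
  where st = step-unboxed-stable T s
IsTerm′-step {app t u} (app T U d₁ d₂) (ξappl s) =
  app (IsTerm′-step T s) U
      (λ x → *≡0-transferˡ (no x u) (boxed≡0 st x) (d₁ x))
      (λ x → *≡0-transferˡ (boxed x u) (UnboxedStable-no≡0 st x) (d₂ x))
  where st = step-unboxed-stable T s
IsTerm′-step {app t u} (app T U d₁ d₂) (ξappr s) =
  app T (IsTerm′-step U s)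
      (λ x → *≡0-transferʳ (boxed x t) (UnboxedStable-no≡0 st x) (d₁ x))
      (λ x → *≡0-transferʳ (no x t) (boxed≡0 st x) (d₂ x))
  where st = step-unboxed-stable U s
IsTerm′-step (bang T b0 n≤1) (ξbang s) =
  bang (IsTerm′-step T s) (λ x → boxed≡0 st x (b0 x)) (λ x → ≤-trans (no-≤ st x (b0 x)) (n≤1 x))
  where st = step-unboxed-stable T s
IsTerm′-step {letb u t} (letb U T d₁ d₂) (ξletl s) =
  letb (IsTerm′-step U s) T
       (λ x → *≡0-transferˡ (no (suc x) t) (boxed≡0 st x) (d₁ x))
       (λ x → *≡0-transferˡ (boxed (suc x) t) (UnboxedStable-no≡0 st x) (d₂ x))
  where st = step-unboxed-stable U s
IsTerm′-step {letb u t} (letb U T d₁ d₂) (ξletr s) =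
  letb U (IsTerm′-step T s)
       (λ x → *≡0-transferʳ (boxed x u) (UnboxedStable-no≡0 st (suc x)) (d₁ x))
       (λ x → *≡0-transferʳ (no x u) (boxed≡0 st (suc x)) (d₂ x))
  where st = step-unboxed-stable T s

TV⇒boxed>0 : ∀ t x → TV t x → 1 ≤ boxed x t
TV⇒boxed>0 (lam t)    x tv        = TV⇒boxed>0 t (suc x) tv
TV⇒boxed>0 (app t u)  x (inj₁ tv) = ≤-trans (TV⇒boxed>0 t x tv) (m≤m+n _ _)
TV⇒boxed>0 (app t u)  x (inj₂ tv) = ≤-trans (TV⇒boxed>0 u x tv) (m≤n+m _ _)
TV⇒boxed>0 (bang t)   x fv        = fv
TV⇒boxed>0 (letb u t) x (inj₁ tv) = ≤-trans (TV⇒boxed>0 u x tv) (m≤m+n _ _)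
TV⇒boxed>0 (letb u t) x (inj₂ tv) = ≤-trans (TV⇒boxed>0 t (suc x) tv) (m≤n+m _ _)

private
  1≤+ : ∀ a {b} → 1 ≤ a + b → 1 ≤ a ⊎ 1 ≤ b
  1≤+ zero    1≤b = inj₂ 1≤b
  1≤+ (suc a) _   = inj₁ (s≤s z≤n)

boxed>0⇒TV : ∀ t x → 1 ≤ boxed x t → TV t x
boxed>0⇒TV (lam t)    x pos = boxed>0⇒TV t (suc x) pos
boxed>0⇒TV (app t u)  x pos with 1≤+ (boxed x t) pos
... | inj₁ pos′ = inj₁ (boxed>0⇒TV t x pos′)
... | inj₂ pos′ = inj₂ (boxed>0⇒TV u x pos′)
boxed>0⇒TV (bang t)   x pos = pos
boxed>0⇒TV (letb u t) x pos with 1≤+ (boxed x u) pos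
... | inj₁ pos′ = inj₁ (boxed>0⇒TV u x pos′)
... | inj₂ pos′ = inj₂ (boxed>0⇒TV t (suc x) pos′)

private
  ¬1≤⇒≡0 : ∀ {n} → ¬ 1 ≤ n → n ≡ 0
  ¬1≤⇒≡0 ¬1≤n = n<1⇒n≡0 (≰⇒> ¬1≤n)

  ≡0⇒¬1≤ : ∀ {n} → n ≡ 0 → ¬ 1 ≤ n
  ≡0⇒¬1≤ refl ()

  disjoint⇒*≡0 : ∀ a b → (1 ≤ a → ¬ 1 ≤ b) → a * b ≡ 0
  disjoint⇒*≡0 zero    b       _ = refl
  disjoint⇒*≡0 (suc a) zero    _ = *-zeroʳ (suc a)
  disjoint⇒*≡0 (suc a) (suc b) f = ⊥-elim (f (s≤s z≤n) (s≤s z≤n))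

  *≡0⇒disjoint : ∀ a b → a * b ≡ 0 → 1 ≤ a → ¬ 1 ≤ b
  *≡0⇒disjoint a b ab≡0 1≤a with m*n≡0⇒m≡0∨n≡0 a ab≡0
  ... | inj₁ a≡0 = ⊥-elim (≡0⇒¬1≤ a≡0 1≤a)
  ... | inj₂ b≡0 = ≡0⇒¬1≤ b≡0

  pos⇒≡1⇒≤1 : ∀ {n} → (1 ≤ n → n ≡ 1) → n ≤ 1
  pos⇒≡1⇒≤1 {zero}  _ = z≤n
  pos⇒≡1⇒≤1 {suc n} f = ≤-reflexive (f (s≤s z≤n))

IsTerm⇒IsTerm′ : ∀ {t} → IsTerm t → IsTerm′ t
IsTerm⇒IsTerm′ (var x) = var x
IsTerm⇒IsTerm′ {lam t} (lam T ¬tv n≤1) =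
  lam (IsTerm⇒IsTerm′ T) (¬1≤⇒≡0 (¬tv ∘ boxed>0⇒TV t 0)) n≤1
IsTerm⇒IsTerm′ {app t u} (app T U d₁ d₂) =
  app (IsTerm⇒IsTerm′ T) (IsTerm⇒IsTerm′ U)
      (λ x → disjoint⇒*≡0 (boxed x t) (no x u) (d₁ x ∘ boxed>0⇒TV t x))
      (λ x → disjoint⇒*≡0 (no x t) (boxed x u) (λ fv → d₂ x fv ∘ boxed>0⇒TV u x))
IsTerm⇒IsTerm′ {bang t} (bang T ¬tv once) =
  bang (IsTerm⇒IsTerm′ T) (λ x → ¬1≤⇒≡0 (¬tv x ∘ boxed>0⇒TV t x)) (λ x → pos⇒≡1⇒≤1 (once x))
IsTerm⇒IsTerm′ {letb u t} (letb U T d₁ d₂) =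
  letb (IsTerm⇒IsTerm′ U) (IsTerm⇒IsTerm′ T)
       (λ x → disjoint⇒*≡0 (boxed x u) (no (suc x) t) (d₁ x ∘ boxed>0⇒TV u x))
       (λ x → disjoint⇒*≡0 (no x u) (boxed (suc x) t) (λ fv → d₂ x fv ∘ boxed>0⇒TV t (suc x)))

IsTerm′⇒IsTerm : ∀ {t} → IsTerm′ t → IsTerm t
IsTerm′⇒IsTerm (var x) = var x
IsTerm′⇒IsTerm {lam t} (lam T b0 n≤1) =
  lam (IsTerm′⇒IsTerm T) (≡0⇒¬1≤ b0 ∘ TV⇒boxed>0 t 0) n≤1
IsTerm′⇒IsTerm {app t u} (app T U d₁ d₂) =
  app (IsTerm′⇒IsTerm T) (IsTerm′⇒IsTerm U)
      (λ x → *≡0⇒disjoint (boxed x t) (no x u) (d₁ x) ∘ TV⇒boxed>0 t x)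
      (λ x fv → *≡0⇒disjoint (no x t) (boxed x u) (d₂ x) fv ∘ TV⇒boxed>0 u x)
IsTerm′⇒IsTerm {bang t} (bang T b0 n≤1) =
  bang (IsTerm′⇒IsTerm T) (λ x → ≡0⇒¬1≤ (b0 x) ∘ TV⇒boxed>0 t x) (λ x → ≤-antisym (n≤1 x))
IsTerm′⇒IsTerm {letb u t} (letb U T d₁ d₂) =
  letb (IsTerm′⇒IsTerm U) (IsTerm′⇒IsTerm T)
       (λ x → *≡0⇒disjoint (boxed x u) (no (suc x) t) (d₁ x) ∘ TV⇒boxed>0 u x)
       (λ x fv → *≡0⇒disjoint (no x u) (boxed (suc x) t) (d₂ x) fv ∘ TV⇒boxed>0 t (suc x))

IsTerm′-⟶* : ∀ {t t′} → IsTerm′ t → t ⟶* t′ → IsTerm′ t′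
IsTerm′-⟶* T ε        = T
IsTerm′-⟶* T (s ◅ ss) = IsTerm′-⟶* (IsTerm′-step T s) ss

IsTerm-⟶* : ∀ {t t′} → IsTerm t → t ⟶* t′ → IsTerm t′
IsTerm-⟶* T steps = IsTerm′⇒IsTerm (IsTerm′-⟶* (IsTerm⇒IsTerm′ T) steps)

infix 4 _↦β_ _↦c_ _⟶β_ _⟶c_ _⟶β*_ _⟶c*_ _⇒β_

-- Confluence

data Compatible (R : Rel PTerm 0ℓ) : Rel PTerm 0ℓ where
  root  : ∀ {t t′} → R t t′ → Compatible R t t′
  ξlam  : ∀ {t t′} → Compatible R t t′ → Compatible R (lam t) (lam t′)
  ξappl : ∀ {t t′ u} → Compatible R t t′ → Compatible R (app t u) (app t′ u)
  ξappr : ∀ {t u u′} → Compatible R u u′ → Compatible R (app t u) (app t u′)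
  ξbang : ∀ {t t′} → Compatible R t t′ → Compatible R (bang t) (bang t′)
  ξletl : ∀ {u u′ t} → Compatible R u u′ → Compatible R (letb u t) (letb u′ t)
  ξletr : ∀ {u t t′} → Compatible R t t′ → Compatible R (letb u t) (letb u t′)

data _↦β_ : Rel PTerm 0ℓ where
  β  : ∀ {t u} → app (lam t) u ↦β t [ u ]
  !β : ∀ {u t} → letb (bang u) t ↦β t [ u ]

data _↦c_ : Rel PTerm 0ℓ where
  com1 : ∀ {t₁ t₂ t₃} → letb (letb t₁ t₂) t₃ ↦c letb t₁ (letb t₂ (shift 1 t₃))
  com2 : ∀ {t₁ t₂ t₃} → app (letb t₁ t₂) t₃ ↦c letb t₁ (app t₂ (shift 0 t₃))

_⟶β_ _⟶c_ _⟶β*_ _⟶c*_ : Rel PTerm 0ℓ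
_⟶β_  = Compatible _↦β_
_⟶c_  = Compatible _↦c_
_⟶β*_ = Star _⟶β_
_⟶c*_ = Star _⟶c_

module _ {R : Rel PTerm 0ℓ} where

  Compatible⇒⟶ : R ⇒ _⟶_ → Compatible R ⇒ _⟶_
  Compatible⇒⟶ R⇒⟶ (root r)  = R⇒⟶ r
  Compatible⇒⟶ R⇒⟶ (ξlam s)  = ξlam  (Compatible⇒⟶ R⇒⟶ s)
  Compatible⇒⟶ R⇒⟶ (ξappl s) = ξappl (Compatible⇒⟶ R⇒⟶ s)
  Compatible⇒⟶ R⇒⟶ (ξappr s) = ξappr (Compatible⇒⟶ R⇒⟶ s)
  Compatible⇒⟶ R⇒⟶ (ξbang s) = ξbang (Compatible⇒⟶ R⇒⟶ s)
  Compatible⇒⟶ R⇒⟶ (ξletl s) = ξletl (Compatible⇒⟶ R⇒⟶ s)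
  Compatible⇒⟶ R⇒⟶ (ξletr s) = ξletr (Compatible⇒⟶ R⇒⟶ s)

  Compatible-shift : (∀ c {t t′} → R t t′ → R (shift c t) (shift c t′)) →
    ∀ c {t t′} → Compatible R t t′ → Compatible R (shift c t) (shift c t′)
  Compatible-shift R-shift c (root r)  = root (R-shift c r)
  Compatible-shift R-shift c (ξlam s)  = ξlam  (Compatible-shift R-shift (suc c) s)
  Compatible-shift R-shift c (ξappl s) = ξappl (Compatible-shift R-shift c s)
  Compatible-shift R-shift c (ξappr s) = ξappr (Compatible-shift R-shift c s)
  Compatible-shift R-shift c (ξbang s) = ξbang (Compatible-shift R-shift c s)
  Compatible-shift R-shift c (ξletl s) = ξletl (Compatible-shift R-shift c s)
  Compatible-shift R-shift c (ξletr s) = ξletr (Compatible-shift R-shift (suc c) s)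

  Compatible-subst : (∀ j u {t t′} → R t t′ → R (subst j u t) (subst j u t′)) →
    ∀ j u {t t′} → Compatible R t t′ → Compatible R (subst j u t) (subst j u t′)
  Compatible-subst R-subst j u (root r)  = root (R-subst j u r)
  Compatible-subst R-subst j u (ξlam s)  = ξlam  (Compatible-subst R-subst (suc j) (shift 0 u) s)
  Compatible-subst R-subst j u (ξappl s) = ξappl (Compatible-subst R-subst j u s)
  Compatible-subst R-subst j u (ξappr s) = ξappr (Compatible-subst R-subst j u s)
  Compatible-subst R-subst j u (ξbang s) = ξbang (Compatible-subst R-subst j u s)
  Compatible-subst R-subst j u (ξletl s) = ξletl (Compatible-subst R-subst j u s)
  Compatible-subst R-subst j u (ξletr s) = ξletr (Compatible-subst R-subst (suc j) (shift 0 u) s)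

  ξlam* : ∀ {t t′} → Star (Compatible R) t t′ → Star (Compatible R) (lam t) (lam t′)
  ξlam* = gmap lam ξlam

  ξappl* : ∀ {t t′ u} → Star (Compatible R) t t′ → Star (Compatible R) (app t u) (app t′ u)
  ξappl* {u = u} = gmap (λ t → app t u) ξappl

  ξappr* : ∀ {t u u′} → Star (Compatible R) u u′ → Star (Compatible R) (app t u) (app t u′)
  ξappr* {t} = gmap (app t) ξappr

  ξbang* : ∀ {t t′} → Star (Compatible R) t t′ → Star (Compatible R) (bang t) (bang t′)
  ξbang* = gmap bang ξbang

  ξletl* : ∀ {u u′ t} → Star (Compatible R) u u′ → Star (Compatible R) (letb u t) (letb u′ t)
  ξletl* {t = t} = gmap (λ u → letb u t) ξletl

  ξletr* : ∀ {u t t′} → Star (Compatible R) t t′ → Star (Compatible R) (letb u t) (letb u t′)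
  ξletr* {u} = gmap (letb u) ξletr

⟶⇒⟶c∪⟶β : _⟶_ ⇒ _⟶c_ ∪ _⟶β_
⟶⇒⟶c∪⟶β β         = inj₂ (root β)
⟶⇒⟶c∪⟶β !β        = inj₂ (root !β)
⟶⇒⟶c∪⟶β com1      = inj₁ (root com1)
⟶⇒⟶c∪⟶β com2      = inj₁ (root com2)
⟶⇒⟶c∪⟶β (ξlam s)  = Sum.map ξlam  ξlam  (⟶⇒⟶c∪⟶β s)
⟶⇒⟶c∪⟶β (ξappl s) = Sum.map ξappl ξappl (⟶⇒⟶c∪⟶β s)
⟶⇒⟶c∪⟶β (ξappr s) = Sum.map ξappr ξappr (⟶⇒⟶c∪⟶β s)
⟶⇒⟶c∪⟶β (ξbang s) = Sum.map ξbang ξbang (⟶⇒⟶c∪⟶β s)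
⟶⇒⟶c∪⟶β (ξletl s) = Sum.map ξletl ξletl (⟶⇒⟶c∪⟶β s)
⟶⇒⟶c∪⟶β (ξletr s) = Sum.map ξletr ξletr (⟶⇒⟶c∪⟶β s)

⟶c∪⟶β⇒⟶ : _⟶c_ ∪ _⟶β_ ⇒ _⟶_
⟶c∪⟶β⇒⟶ = Sum.[ Compatible⇒⟶ (λ { com1 → com1 ; com2 → com2 })
               , Compatible⇒⟶ (λ { β → β ; !β → !β }) ]

↦β-shift : ∀ c {t t′} → t ↦β t′ → shift c t ↦β shift c t′
↦β-shift c {app (lam t) u}    β  rewrite shift-subst-≥ c 0 u t z≤n = β
↦β-shift c {letb (bang u) t} !β rewrite shift-subst-≥ c 0 u t z≤n = !β

↦c-shift : ∀ c {t t′} → t ↦c t′ → shift c t ↦c shift c t′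
↦c-shift c {letb (letb t₁ t₂) t₃} com1 rewrite shift-comm 1 (suc c) t₃ (s≤s z≤n) = com1
↦c-shift c {app (letb t₁ t₂) t₃} com2 rewrite shift-shift0 c t₃ = com2

↦c-subst : ∀ j u {t t′} → t ↦c t′ → subst j u t ↦c subst j u t′
↦c-subst j u {letb (letb t₁ t₂) t₃} com1
  rewrite sym (shift-shift0 0 u) | sym (shift-subst-≤ 1 (suc j) (shift 0 u) t₃ (s≤s z≤n)) = com1
↦c-subst j u {app (letb t₁ t₂) t₃} com2 rewrite sym (shift-subst-≤ 0 j u t₃ z≤n) = com2

⟶β-shift : ∀ c {t t′} → t ⟶β t′ → shift c t ⟶β shift c t′
⟶β-shift = Compatible-shift ↦β-shift

⟶c-shift : ∀ c {t t′} → t ⟶c t′ → shift c t ⟶c shift c t′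
⟶c-shift = Compatible-shift ↦c-shift

⟶c-subst : ∀ j u {t t′} → t ⟶c t′ → subst j u t ⟶c subst j u t′
⟶c-subst = Compatible-subst ↦c-subst

⟶c-subst-arg : ∀ {u u′} → u ⟶c u′ → ∀ j t → subst j u t ⟶c* subst j u′ t
⟶c-subst-arg s j (var x) with varSubst j x
... | nothing = return s
... | just _  = ε
⟶c-subst-arg s j (lam t)    = ξlam* (⟶c-subst-arg (⟶c-shift 0 s) (suc j) t)
⟶c-subst-arg s j (app t r)  = ξappl* (⟶c-subst-arg s j t) ◅◅ ξappr* (⟶c-subst-arg s j r)
⟶c-subst-arg s j (bang t)   = ξbang* (⟶c-subst-arg s j t)
⟶c-subst-arg s j (letb r t) =
  ξletl* (⟶c-subst-arg s j r) ◅◅ ξletr* (⟶c-subst-arg (⟶c-shift 0 s) (suc j) t)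

data _⇒β_ : Rel PTerm 0ℓ where
  var  : ∀ x → var x ⇒β var x
  lam  : ∀ {t t′} → t ⇒β t′ → lam t ⇒β lam t′
  app  : ∀ {t t′ u u′} → t ⇒β t′ → u ⇒β u′ → app t u ⇒β app t′ u′
  bang : ∀ {t t′} → t ⇒β t′ → bang t ⇒β bang t′
  letb : ∀ {u u′ t t′} → u ⇒β u′ → t ⇒β t′ → letb u t ⇒β letb u′ t′
  β    : ∀ {t t′ u u′} → t ⇒β t′ → u ⇒β u′ → app (lam t) u ⇒β t′ [ u′ ]
  !β   : ∀ {u u′ t t′} → u ⇒β u′ → t ⇒β t′ → letb (bang u) t ⇒β t′ [ u′ ]

⇒β-refl : ∀ t → t ⇒β t
⇒β-refl (var x)    = var x
⇒β-refl (lam t)    = lam (⇒β-refl t)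
⇒β-refl (app t u)  = app (⇒β-refl t) (⇒β-refl u)
⇒β-refl (bang t)   = bang (⇒β-refl t)
⇒β-refl (letb u t) = letb (⇒β-refl u) (⇒β-refl t)

⇒β-shift : ∀ c {t t′} → t ⇒β t′ → shift c t ⇒β shift c t′
⇒β-shift c (var x)    = var (shiftVar c x)
⇒β-shift c (lam p)    = lam (⇒β-shift (suc c) p)
⇒β-shift c (app p q)  = app (⇒β-shift c p) (⇒β-shift c q)
⇒β-shift c (bang p)   = bang (⇒β-shift c p)
⇒β-shift c (letb p q) = letb (⇒β-shift c p) (⇒β-shift (suc c) q)
⇒β-shift c (β {t′ = t′} {u′ = u′} p q) rewrite shift-subst-≥ c 0 u′ t′ z≤n =
  β (⇒β-shift (suc c) p) (⇒β-shift c q)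
⇒β-shift c (!β {u′ = u′} {t′ = t′} p q) rewrite shift-subst-≥ c 0 u′ t′ z≤n =
  !β (⇒β-shift c p) (⇒β-shift (suc c) q)

⇒β-subst : ∀ j {t t′ u u′} → t ⇒β t′ → u ⇒β u′ → subst j u t ⇒β subst j u′ t′
⇒β-subst j (var x) q with varSubst j x
... | nothing = q
... | just y  = var y
⇒β-subst j (lam p)    q = lam (⇒β-subst (suc j) p (⇒β-shift 0 q))
⇒β-subst j (app p p′) q = app (⇒β-subst j p q) (⇒β-subst j p′ q)
⇒β-subst j (bang p)   q = bang (⇒β-subst j p q)
⇒β-subst j (letb p p′) q = letb (⇒β-subst j p q) (⇒β-subst (suc j) p′ (⇒β-shift 0 q))
⇒β-subst j {u′ = w′} (β {t′ = t′} {u′ = s′} p p′) q rewrite subst-subst 0 j s′ w′ t′ z≤n =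
  β (⇒β-subst (suc j) p (⇒β-shift 0 q)) (⇒β-subst j p′ q)
⇒β-subst j {u′ = w′} (!β {u′ = s′} {t′ = t′} p p′) q rewrite subst-subst 0 j s′ w′ t′ z≤n =
  !β (⇒β-subst j p q) (⇒β-subst (suc j) p′ (⇒β-shift 0 q))

develop : PTerm → PTerm
develop (var x)           = var x
develop (lam t)           = lam (develop t)
develop (app (lam t) u)   = develop t [ develop u ]
develop (app t u)         = app (develop t) (develop u)
develop (bang t)          = bang (develop t)
develop (letb (bang u) t) = develop t [ develop u ]
develop (letb u t)        = letb (develop u) (develop t)

⇒β-develop : ∀ {t t′} → t ⇒β t′ → t′ ⇒β develop t
⇒β-develop (var x)                = var x
⇒β-develop (lam p)                = lam (⇒β-develop p)
⇒β-develop (app {var _} p q)      = app (⇒β-develop p) (⇒β-develop q)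
⇒β-develop (app {lam _} (lam p) q) = β (⇒β-develop p) (⇒β-develop q)
⇒β-develop (app {app _ _} p q)    = app (⇒β-develop p) (⇒β-develop q)
⇒β-develop (app {bang _} p q)     = app (⇒β-develop p) (⇒β-develop q)
⇒β-develop (app {letb _ _} p q)   = app (⇒β-develop p) (⇒β-develop q)
⇒β-develop (bang p)               = bang (⇒β-develop p)
⇒β-develop (letb {var _} p q)     = letb (⇒β-develop p) (⇒β-develop q)
⇒β-develop (letb {lam _} p q)     = letb (⇒β-develop p) (⇒β-develop q)
⇒β-develop (letb {app _ _} p q)   = letb (⇒β-develop p) (⇒β-develop q)
⇒β-develop (letb {bang _} (bang p) q) = !β (⇒β-develop p) (⇒β-develop q)
⇒β-develop (letb {letb _ _} p q)  = letb (⇒β-develop p) (⇒β-develop q)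
⇒β-develop (β p q)                = ⇒β-subst 0 (⇒β-develop p) (⇒β-develop q)
⇒β-develop (!β p q)               = ⇒β-subst 0 (⇒β-develop q) (⇒β-develop p)

⟶β⇒⇒β : _⟶β_ ⇒ _⇒β_
⟶β⇒⇒β {app (lam t) u}    (root β)  = β (⇒β-refl t) (⇒β-refl u)
⟶β⇒⇒β {letb (bang u) t} (root !β) = !β (⇒β-refl u) (⇒β-refl t)
⟶β⇒⇒β (ξlam s)                     = lam (⟶β⇒⇒β s)
⟶β⇒⇒β {app _ u} (ξappl s)          = app (⟶β⇒⇒β s) (⇒β-refl u)
⟶β⇒⇒β {app t _} (ξappr s)          = app (⇒β-refl t) (⟶β⇒⇒β s)
⟶β⇒⇒β (ξbang s)                    = bang (⟶β⇒⇒β s)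
⟶β⇒⇒β {letb _ t} (ξletl s)         = letb (⟶β⇒⇒β s) (⇒β-refl t)
⟶β⇒⇒β {letb u _} (ξletr s)         = letb (⇒β-refl u) (⟶β⇒⇒β s)

⇒β⇒⟶β* : _⇒β_ ⇒ _⟶β*_
⇒β⇒⟶β* (var x)    = ε
⇒β⇒⟶β* (lam p)    = ξlam* (⇒β⇒⟶β* p)
⇒β⇒⟶β* (app p q)  = ξappl* (⇒β⇒⟶β* p) ◅◅ ξappr* (⇒β⇒⟶β* q)
⇒β⇒⟶β* (bang p)   = ξbang* (⇒β⇒⟶β* p)
⇒β⇒⟶β* (letb p q) = ξletl* (⇒β⇒⟶β* p) ◅◅ ξletr* (⇒β⇒⟶β* q)
⇒β⇒⟶β* (β p q)    = ξappl* (ξlam* (⇒β⇒⟶β* p)) ◅◅ ξappr* (⇒β⇒⟶β* q) ◅◅ return (root β)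
⇒β⇒⟶β* (!β p q)   = ξletl* (ξbang* (⇒β⇒⟶β* p)) ◅◅ ξletr* (⇒β⇒⟶β* q) ◅◅ return (root !β)

⟶β-confluent : Confluent _⟶β_
⟶β-confluent = confluent-between ⟶β⇒⇒β ⇒β⇒⟶β*
  (diamond⇒confluent λ {t} p q → develop t , ⇒β-develop p , ⇒β-develop q)

-- Heads of applications and lets count twice, so com1 and com2, which move a let
-- out of head position, make the weight drop.
weight : PTerm → ℕ
weight (var x)    = 1
weight (lam t)    = suc (weight t)
weight (app t u)  = 2 * weight t + weight u
weight (bang t)   = suc (weight t)
weight (letb u t) = 2 * weight u + weight t

weight-positive : ∀ t → 1 ≤ weight t
weight-positive (var x)    = ≤-refl
weight-positive (lam t)    = s≤s z≤n
weight-positive (app t u)  = ≤-trans (weight-positive t) (≤-trans (m≤m+n _ _) (m≤m+n _ (weight u)))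
weight-positive (bang t)   = s≤s z≤n
weight-positive (letb u t) = ≤-trans (weight-positive u) (≤-trans (m≤m+n _ _) (m≤m+n _ (weight t)))

weight-shift : ∀ c t → weight (shift c t) ≡ weight t
weight-shift c (var x)    = refl
weight-shift c (lam t)    = cong suc (weight-shift (suc c) t)
weight-shift c (app t u)  = cong₂ (λ m n → 2 * m + n) (weight-shift c t) (weight-shift c u)
weight-shift c (bang t)   = cong suc (weight-shift c t)
weight-shift c (letb u t) = cong₂ (λ m n → 2 * m + n) (weight-shift c u) (weight-shift (suc c) t)

private
  commuting-conversion-< : ∀ a b c → 1 ≤ a → 2 * a + (2 * b + c) < 2 * (2 * a + b) + c
  commuting-conversion-< a b c 1≤a =
    <-≤-trans (m<m+n (2 * a + (2 * b + c)) (≤-trans 1≤a (m≤m+n a (a + 0))))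
              (≤-reflexive (sym (reassociate a b c)))
    where
    open +-*-Solver
    reassociate : ∀ a b c → 2 * (2 * a + b) + c ≡ 2 * a + (2 * b + c) + 2 * a
    reassociate = solve 3 (λ a b c → con 2 :* (con 2 :* a :+ b) :+ c
                                  := con 2 :* a :+ (con 2 :* b :+ c) :+ con 2 :* a) refl

⟶c-decreasing : ∀ {t t′} → t ⟶c t′ → weight t′ < weight t
⟶c-decreasing {letb (letb t₁ t₂) t₃} (root com1) rewrite weight-shift 1 t₃ =
  commuting-conversion-< (weight t₁) (weight t₂) (weight t₃) (weight-positive t₁)
⟶c-decreasing {app (letb t₁ t₂) t₃}  (root com2) rewrite weight-shift 0 t₃ =
  commuting-conversion-< (weight t₁) (weight t₂) (weight t₃) (weight-positive t₁)
⟶c-decreasing (ξlam s)               = s≤s (⟶c-decreasing s)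
⟶c-decreasing {app _ u} (ξappl s)    = +-monoˡ-< (weight u) (*-monoʳ-< 2 (⟶c-decreasing s))
⟶c-decreasing {app t _} (ξappr s)    = +-monoʳ-< (2 * weight t) (⟶c-decreasing s)
⟶c-decreasing (ξbang s)              = s≤s (⟶c-decreasing s)
⟶c-decreasing {letb _ t} (ξletl s)   = +-monoˡ-< (weight t) (*-monoʳ-< 2 (⟶c-decreasing s))
⟶c-decreasing {letb u _} (ξletr s)   = +-monoʳ-< (2 * weight u) (⟶c-decreasing s)

com1≡ : ∀ {t₁ t₂ t₃ t} → shift 1 t₃ ≡ t → letb (letb t₁ t₂) t₃ ⟶c letb t₁ (letb t₂ t)
com1≡ refl = root com1

!β≡ : ∀ {u t t′} → t [ u ] ≡ t′ → letb (bang u) t ⟶β t′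
!β≡ refl = root !β

private
  com1-critical : ∀ {t₁ t₂ t₃ t′} → letb (letb t₁ t₂) t₃ ⟶c t′ →
    ∃ λ d → letb t₁ (letb t₂ (shift 1 t₃)) ⟶c* d × t′ ⟶c* d
  com1-critical (root com1) = -, ε , ε
  com1-critical {t₂ = t₂} {t₃} (ξletl (root com1)) =
    -, return (com1≡ (cong (letb (shift 1 t₂)) (shift-comm 1 1 t₃ ≤-refl))) ,
       root com1 ◅ return (ξletr (root com1))
  com1-critical (ξletl (ξletl s)) = -, return (ξletl s) , return (root com1)
  com1-critical (ξletl (ξletr s)) = -, return (ξletr (ξletl s)) , return (root com1)
  com1-critical (ξletr s)         = -, return (ξletr (ξletr (⟶c-shift 1 s))) , return (root com1)

  com2-critical : ∀ {t₁ t₂ t₃ t′} → app (letb t₁ t₂) t₃ ⟶c t′ →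
    ∃ λ d → letb t₁ (app t₂ (shift 0 t₃)) ⟶c* d × t′ ⟶c* d
  com2-critical (root com2) = -, ε , ε
  com2-critical {t₂ = t₂} {t₃} (ξappl (root com1)) =
    -, return (com1≡ (cong (app (shift 1 t₂)) (shift-shift0 0 t₃))) ,
       root com2 ◅ return (ξletr (root com2))
  com2-critical (ξappl (ξletl s)) = -, return (ξletl s) , return (root com2)
  com2-critical (ξappl (ξletr s)) = -, return (ξletr (ξappl s)) , return (root com2)
  com2-critical (ξappr s)         = -, return (ξletr (ξappr (⟶c-shift 0 s))) , return (root com2)

  swap : ∀ {b c} → (∃ λ d → b ⟶c* d × c ⟶c* d) → ∃ λ d → c ⟶c* d × b ⟶c* d
  swap (d , p , q) = d , q , p

⟶c-weakly-confluent : WeaklyConfluent _⟶c_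
⟶c-weakly-confluent (root com1) s = com1-critical s
⟶c-weakly-confluent (root com2) s = com2-critical s
⟶c-weakly-confluent s (root com1) = swap (com1-critical s)
⟶c-weakly-confluent s (root com2) = swap (com2-critical s)
⟶c-weakly-confluent (ξlam s) (ξlam s′) with ⟶c-weakly-confluent s s′
... | _ , p , q = -, ξlam* p , ξlam* q
⟶c-weakly-confluent (ξappl s) (ξappl s′) with ⟶c-weakly-confluent s s′
... | _ , p , q = -, ξappl* p , ξappl* q
⟶c-weakly-confluent (ξappl s) (ξappr s′) = -, return (ξappr s′) , return (ξappl s)
⟶c-weakly-confluent (ξappr s) (ξappl s′) = -, return (ξappl s′) , return (ξappr s)
⟶c-weakly-confluent (ξappr s) (ξappr s′) with ⟶c-weakly-confluent s s′
... | _ , p , q = -, ξappr* p , ξappr* q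
⟶c-weakly-confluent (ξbang s) (ξbang s′) with ⟶c-weakly-confluent s s′
... | _ , p , q = -, ξbang* p , ξbang* q
⟶c-weakly-confluent (ξletl s) (ξletl s′) with ⟶c-weakly-confluent s s′
... | _ , p , q = -, ξletl* p , ξletl* q
⟶c-weakly-confluent (ξletl s) (ξletr s′) = -, return (ξletr s′) , return (ξletl s)
⟶c-weakly-confluent (ξletr s) (ξletl s′) = -, return (ξletl s′) , return (ξletr s)
⟶c-weakly-confluent (ξletr s) (ξletr s′) with ⟶c-weakly-confluent s s′
... | _ , p , q = -, ξletr* p , ξletr* q

⟶c-confluent : Confluent _⟶c_
⟶c-confluent = sn&wcr⇒cr (measure⇒sn⁺ weight ⟶c-decreasing) ⟶c-weakly-confluent

⟶c-⟶β-local : ∀ {a b c} → a ⟶c b → a ⟶β c →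
  ∃ λ d → (b ≡ d ⊎ b ⟶β d) × c ⟶c* d
⟶c-⟶β-local {letb (letb (bang u) t₂) t₃} (root com1) (ξletl (root !β)) =
  -, inj₂ (!β≡ (cong (letb (t₂ [ u ])) (subst-shift-cancel 1 (shift 0 u) t₃))) , ε
⟶c-⟶β-local (root com1) (ξletl (ξletl s)) = -, inj₂ (ξletl s) , return (root com1)
⟶c-⟶β-local (root com1) (ξletl (ξletr s)) = -, inj₂ (ξletr (ξletl s)) , return (root com1)
⟶c-⟶β-local (root com1) (ξletr s) = -, inj₂ (ξletr (ξletr (⟶β-shift 1 s))) , return (root com1)
⟶c-⟶β-local {app (letb (bang u) t₂) t₃} (root com2) (ξappl (root !β)) =
  -, inj₂ (!β≡ (cong (app (t₂ [ u ])) (subst-shift-cancel 0 u t₃))) , ε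
⟶c-⟶β-local (root com2) (ξappl (ξletl s)) = -, inj₂ (ξletl s) , return (root com2)
⟶c-⟶β-local (root com2) (ξappl (ξletr s)) = -, inj₂ (ξletr (ξappl s)) , return (root com2)
⟶c-⟶β-local (root com2) (ξappr s) = -, inj₂ (ξletr (ξappr (⟶β-shift 0 s))) , return (root com2)
⟶c-⟶β-local {app (lam t) u} (ξappl (ξlam s)) (root β) =
  -, inj₂ (root β) , return (⟶c-subst 0 u s)
⟶c-⟶β-local {app (lam t) u} (ξappr s) (root β) =
  -, inj₂ (root β) , ⟶c-subst-arg s 0 t
⟶c-⟶β-local {letb (bang u) t} (ξletl (ξbang s)) (root !β) =
  -, inj₂ (root !β) , ⟶c-subst-arg s 0 t
⟶c-⟶β-local {letb (bang u) t} (ξletr s) (root !β) =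
  -, inj₂ (root !β) , return (⟶c-subst 0 u s)
⟶c-⟶β-local (ξlam s) (ξlam s′) with ⟶c-⟶β-local s s′
... | _ , o , p = -, Sum.map (cong lam) ξlam o , ξlam* p
⟶c-⟶β-local {app _ u} (ξappl s) (ξappl s′) with ⟶c-⟶β-local s s′
... | _ , o , p = -, Sum.map (cong (λ t → app t u)) ξappl o , ξappl* p
⟶c-⟶β-local (ξappl s) (ξappr s′) = -, inj₂ (ξappr s′) , return (ξappl s)
⟶c-⟶β-local (ξappr s) (ξappl s′) = -, inj₂ (ξappl s′) , return (ξappr s)
⟶c-⟶β-local {app t _} (ξappr s) (ξappr s′) with ⟶c-⟶β-local s s′
... | _ , o , p = -, Sum.map (cong (app t)) ξappr o , ξappr* p
⟶c-⟶β-local (ξbang s) (ξbang s′) with ⟶c-⟶β-local s s′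
... | _ , o , p = -, Sum.map (cong bang) ξbang o , ξbang* p
⟶c-⟶β-local {letb _ t} (ξletl s) (ξletl s′) with ⟶c-⟶β-local s s′
... | _ , o , p = -, Sum.map (cong (λ u → letb u t)) ξletl o , ξletl* p
⟶c-⟶β-local (ξletl s) (ξletr s′) = -, inj₂ (ξletr s′) , return (ξletl s)
⟶c-⟶β-local (ξletr s) (ξletl s′) = -, inj₂ (ξletl s′) , return (ξletr s)
⟶c-⟶β-local {letb u _} (ξletr s) (ξletr s′) with ⟶c-⟶β-local s s′
... | _ , o , p = -, Sum.map (cong (letb u)) ξletr o , ξletr* p

⟶-confluent : Confluent _⟶_
⟶-confluent = confluent-between ⟶⇒⟶c∪⟶β (return ∘ ⟶c∪⟶β⇒⟶)
  (hindley-rosen ⟶c-confluent ⟶β-confluent (local-commutation⇒commute ⟶c-⟶β-local))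

mainTheorem3 : (t u v : PTerm) → IsTerm t → t ⟶* u → t ⟶* v →
    Σ PTerm (λ w → IsTerm w × (u ⟶* w) × (v ⟶* w))
mainTheorem3 t u v T t⟶*u t⟶*v with ⟶-confluent t⟶*u t⟶*v
... | w , u⟶*w , v⟶*w = w , IsTerm-⟶* T (t⟶*u ◅◅ u⟶*w) , u⟶*w , v⟶*w
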